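{- Let $k$ be an odd positive integer and $m\ge1$. Let $L_k(p_1,\dots,p_m;q_1,\dots,q_m)$ be the homogeneous component of total degree $k+1$ of the polynomial $F_k(p_1,\dots,p_m;q_1,\dots,q_m)$. Then every coefficient of the polynomial $-L_k(-p_1,\dots,-p_m;q_1,\dots,q_m)$ is nonnegative.
   Context: Write $x^{\downarrow j}=x(x-1)\cdots(x-j+1)$. For odd $k$, $F_k(p_1,\dots,p_m;q_1,\dots,q_m)$ is defined as $-\frac{1}{4k}$ times the coefficient of $z^{ -1}$ in the expansion, in descending powers of $z$ around $z=\infty$, of $$(2z-k)(z-1)^{\downarrow(k-1)}\prod_{i=1}^m\frac{(z-q_i-1)^{\downarrow k}(z+q_i)^{\downarrow k}}{(z-q_i+p_i-1)^{\downarrow k}(z+q_i-p_i)^{\downarrow k}};$$ this is a polynomial in $p_1,\dots,p_m,q_1,\dots,q_m$ with rational coefficients, of total degree $k+1$. (It equals the normalized spin character $p^\sharp_k$ evaluated on the strict partition $(q_1,q_1-1,\dots,q_1-p_1+1,\,q_2,\dots,q_2-p_2+1,\dots,q_m-p_m+1)$.) -}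

module Defs where

open import Data.Bool using (Bool; true; false; if_then_else_)
open import Data.Nat as ℕ using (ℕ; zero; suc; _∸_; _≡ᵇ_)
open import Data.Integer as ℤ using (ℤ; +_; -[1+_])
open import Data.Rational as ℚ using (ℚ; 0ℚ; 1ℚ)
open import Data.Fin using (Fin; _↑ˡ_; _↑ʳ_)
import Data.Fin as Fin
open import Data.Vec using (Vec; []; _∷_; take)
import Data.Vec as Vec
open import Data.List using (List; []; _∷_; map; concatMap; upTo; foldr)
open import Data.Product using (_×_; _,_)

-- Multivariate polynomials (formal power series) over ℚ in n variables,
-- represented by their coefficient function on exponent vectors.
-- (f e) is the coefficient of the monomial x^e.

Mon : ℕ → Set
Mon n = Vec ℕ n

MPoly : ℕ → Set
MPoly n = Mon n → ℚ

splits : ∀ {n} → Mon n → List (Mon n × Mon n)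
splits [] = ([] , []) ∷ []
splits (e ∷ es) =
  concatMap (λ i → map (λ ab → (i ∷ Data.Product.proj₁ ab , (e ∸ i) ∷ Data.Product.proj₂ ab)) (splits es))
            (upTo (suc e))

sumℚ : List ℚ → ℚ
sumℚ = foldr ℚ._+_ 0ℚ

0P : ∀ {n} → MPoly n
0P _ = 0ℚ

1P : ∀ {n} → MPoly n
1P [] = 1ℚ
1P (zero ∷ es) = 1P es
1P (suc _ ∷ es) = 0ℚ

var : ∀ {n} → Fin n → MPoly n
var Fin.zero (zero ∷ es) = 0ℚ
var Fin.zero (suc zero ∷ es) = 1P es
var Fin.zero (suc (suc _) ∷ es) = 0ℚ
var (Fin.suc i) (zero ∷ es) = var i es
var (Fin.suc i) (suc _ ∷ es) = 0ℚ

cst : ∀ {n} → ℚ → MPoly n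
cst c e = c ℚ.* 1P e

cstℕ : ∀ {n} → ℕ → MPoly n
cstℕ j = cst (+ j ℚ./ 1)

_+P_ : ∀ {n} → MPoly n → MPoly n → MPoly n
(f +P g) e = f e ℚ.+ g e

-P_ : ∀ {n} → MPoly n → MPoly n
(-P f) e = ℚ.- (f e)

_*P_ : ∀ {n} → MPoly n → MPoly n → MPoly n
(f *P g) e = sumℚ (map (λ ab → f (Data.Product.proj₁ ab) ℚ.* g (Data.Product.proj₂ ab)) (splits e))

_^P_ : ∀ {n} → MPoly n → ℕ → MPoly n
f ^P zero = 1P
f ^P suc j = f *P (f ^P j)

scale : ∀ {n} → ℚ → MPoly n → MPoly n
scale c f e = c ℚ.* f e

sumP : ∀ {n} → List (MPoly n) → MPoly n
sumP = foldr _+P_ 0P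

-- Expansions around z = ∞ in descending powers of z, with coefficients
-- in MPoly n:  a pair (s , g) stands for  z^s · Σ_{N ≥ 0} g N · z^(-N).

PS : ℕ → Set
PS n = ℕ → MPoly n

record Lau (n : ℕ) : Set where
  constructor lau
  field
    shift : ℤ
    ser   : PS n
open Lau public

_*PS_ : ∀ {n} → PS n → PS n → PS n
(f *PS g) N = sumP (map (λ i → f i *P g (N ∸ i)) (upTo (suc N)))

_*L_ : ∀ {n} → Lau n → Lau n → Lau n
(lau s f) *L (lau t g) = lau (s ℤ.+ t) (f *PS g)

1L : ∀ {n} → Lau n
1L = lau (+ 0) (λ { zero → 1P ; (suc _) → 0P })

prodL : ∀ {n} → List (Lau n) → Lau n
prodL = foldr _*L_ 1L

-- α z - c  =  z · (α - c z⁻¹)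
affL : ∀ {n} → MPoly n → MPoly n → Lau n
affL α c = lau (+ 1) (λ { zero → α ; (suc zero) → -P c ; (suc (suc _)) → 0P })

linL : ∀ {n} → MPoly n → Lau n
linL c = affL 1P c

-- (z - c)⁻¹ = z⁻¹ · Σ_N c^N z^(-N)   (expansion at z = ∞)
linInvL : ∀ {n} → MPoly n → Lau n
linInvL c = lau (-[1+ 0 ]) (λ N → c ^P N)

ffL : ∀ {n} → MPoly n → ℕ → Lau n
ffL a k = prodL (map (λ j → linL (a +P cstℕ j)) (upTo k))

ffInvL : ∀ {n} → MPoly n → ℕ → Lau n
ffInvL a k = prodL (map (λ j → linInvL (a +P cstℕ j)) (upTo k))

coeffZInv : ∀ {n} → Lau n → MPoly n
coeffZInv (lau s g) with s ℤ.+ + 1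
... | + N = g N
... | -[1+ _ ] = 0P

-- The polynomial F_k in the 2m variables p_1..p_m, q_1..q_m.
-- Variable ordering: p_i is variable (inject+ m i), q_i is (raise m i).

pV : ∀ m → Fin m → MPoly (m ℕ.+ m)
pV m i = var (i ↑ˡ m)

qV : ∀ m → Fin m → MPoly (m ℕ.+ m)
qV m i = var (m ↑ʳ i)

-- 1/(4k) (k ≥ 1; the value at k = 0 is irrelevant)
invFourK : ℕ → ℚ
invFourK zero = 0ℚ
invFourK (suc k) = + 1 ℚ./ (4 ℕ.* suc k)

factorL : ∀ k m → Fin m → Lau (m ℕ.+ m)
factorL k m i =
  ffL (q +P 1P) k *L (ffL (-P q) k *L
  (ffInvL ((q +P (-P p)) +P 1P) k *L ffInvL (p +P (-P q)) k))
  where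
    p = pV m i
    q = qV m i

exprL : ∀ k m → Lau (m ℕ.+ m)
exprL k m =
  affL (cstℕ 2) (cstℕ k) *L (ffL 1P (k ∸ 1) *L
  prodL (map (factorL k m) (Data.List.allFin m)))

F : ∀ k m → MPoly (m ℕ.+ m)
F k m = scale (ℚ.- invFourK k) (coeffZInv (exprL k m))

homComp : ∀ {n} → ℕ → MPoly n → MPoly n
homComp d f e = if Vec.sum e ≡ᵇ d then f e else 0ℚ

signℚ : ℕ → ℚ
signℚ zero = 1ℚ
signℚ (suc j) = ℚ.- signℚ j

-- substitution p_i ↦ -p_i (q unchanged): the coefficient of p^α q^β
-- gets multiplied by (-1)^{|α|}
negP : ∀ m → MPoly (m ℕ.+ m) → MPoly (m ℕ.+ m)
negP m f e = signℚ (Vec.sum (take m e)) ℚ.* f e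

L : ∀ k m → MPoly (m ℕ.+ m)
L k m = homComp (suc k) (F k m)

-- Put t = z⁻¹ and call a polynomial coefficient of t^N "bounded" if its total
-- degree is at most N.  Every factor of the expression defining F_k has the
-- form z^s · A(t) with A bounded: (2z - k), the linear factors z - c and the
-- expansions (z - c)⁻¹ = t Σ_N c^N t^N, with deg c ≤ 1.  On bounded series the
-- map "keep the degree-N part of the coefficient of t^N, then substitute
-- p ↦ -p" (the leading part) is a ring homomorphism.  Writing a = q_i + p_i, the
-- leading part of the whole expression is therefore
--     2 · ∏_i [ (1 - q t)(1 + q t) / ((1 - a t)(1 + a t)) ]^k
--   = 2 · ∏_i [ 1 + (q p + p a) t² Σ_N a^{2N} t^{2N} ]^k,
-- whose coefficients are polynomials with nonnegative coefficients.  Since the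
-- expression is z^k times a bounded series, its coefficient of z⁻¹ is the
-- coefficient of t^{k+1}, and -L_k(-p; q) = (1/4k) · (its leading part) ≥ 0.
--
-- The hypothesis that k is odd is only
-- needed to exclude k = 0.
module Submission where

open import Algebra.Bundles using (CommutativeRing)
open import Data.Nat using (ℕ)
open import Defs

-- This is used twice: polynomials
-- in n+1 variables are power series in the first one, and expansions at
-- z = ∞ are power series in t = z⁻¹.
module PowerSeries {c ℓ} (R : CommutativeRing c ℓ) where
  open import Data.Nat using (ℕ; zero; suc; _∸_; _<_; s≤s; z≤n)
  open import Data.List using (map; foldr; upTo)
  open import Data.List.Properties using (map-upTo; map-applyUpTo)
  open import Data.Product using (_,_)
  open import Function using (_∘_)
  open import Relation.Binary.PropositionalEquality as P using (_≡_)

  open CommutativeRing R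
  open import Relation.Binary.Reasoning.Setoid setoid

  Seq : Set c
  Seq = ℕ → Carrier

  infix 4 _≋_
  _≋_ : Seq → Seq → Set ℓ
  f ≋ g = ∀ N → f N ≈ g N

  sumBelow : ℕ → (ℕ → Carrier) → Carrier
  sumBelow n h = foldr _+_ 0# (map h (upTo n))

  sumBelow-suc : ∀ n h → sumBelow (suc n) h ≡ h 0 + sumBelow n (h ∘ suc)
  sumBelow-suc n h = P.cong (λ l → h 0 + foldr _+_ 0# l)
    (P.trans (map-applyUpTo suc h n) (P.sym (map-upTo (h ∘ suc) n)))

  sumBelow-cong : ∀ n {h h′} → (∀ i → i < n → h i ≈ h′ i) → sumBelow n h ≈ sumBelow n h′
  sumBelow-cong zero eq = refl
  sumBelow-cong (suc n) {h} {h′} eq = begin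
    sumBelow (suc n) h                ≡⟨ sumBelow-suc n h ⟩
    h 0 + sumBelow n (h ∘ suc)
      ≈⟨ +-cong (eq 0 (s≤s z≤n)) (sumBelow-cong n (λ i i<n → eq (suc i) (s≤s i<n))) ⟩
    h′ 0 + sumBelow n (h′ ∘ suc)      ≡⟨ P.sym (sumBelow-suc n h′) ⟩
    sumBelow (suc n) h′               ∎

  infixl 7 _⊛_
  infixl 6 _⊕_

  _⊛_ : Seq → Seq → Seq
  (f ⊛ g) N = sumBelow (suc N) (λ i → f i * g (N ∸ i))

  _⊕_ : Seq → Seq → Seq
  (f ⊕ g) N = f N + g N

  ⊖_ : Seq → Seq
  (⊖ f) N = - f N

  0S 1S : Seq
  0S _ = 0#
  1S zero = 1#
  1S (suc _) = 0#

  _·_ : Carrier → Seq → Seq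
  (c · f) N = c * f N

  dropHead : Seq → Seq
  dropHead f N = f (suc N)

  ⊛-at-0 : ∀ f g → (f ⊛ g) 0 ≈ f 0 * g 0
  ⊛-at-0 f g = +-identityʳ _

  ⊛-at-suc : ∀ f g M → (f ⊛ g) (suc M) ≈ f 0 * g (suc M) + (dropHead f ⊛ g) M
  ⊛-at-suc f g M = reflexive (sumBelow-suc (suc M) (λ i → f i * g (suc M ∸ i)))

  ⊛-at-suc′ : ∀ f g M → (f ⊛ g) (suc M) ≈ (f ⊛ dropHead g) M + f (suc M) * g 0
  ⊛-at-suc′ f g zero = begin
    (f ⊛ g) 1                        ≈⟨ ⊛-at-suc f g 0 ⟩
    f 0 * g 1 + (dropHead f ⊛ g) 0   ≈⟨ +-cong (sym (⊛-at-0 f (dropHead g))) (⊛-at-0 (dropHead f) g) ⟩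
    (f ⊛ dropHead g) 0 + f 1 * g 0   ∎
  ⊛-at-suc′ f g (suc M) = begin
    (f ⊛ g) (suc (suc M))
      ≈⟨ ⊛-at-suc f g (suc M) ⟩
    f 0 * g (suc (suc M)) + (dropHead f ⊛ g) (suc M)
      ≈⟨ +-cong refl (⊛-at-suc′ (dropHead f) g M) ⟩
    f 0 * g (suc (suc M)) + ((dropHead f ⊛ dropHead g) M + f (suc (suc M)) * g 0)
      ≈⟨ sym (+-assoc _ _ _) ⟩
    (f 0 * g (suc (suc M)) + (dropHead f ⊛ dropHead g) M) + f (suc (suc M)) * g 0
      ≈⟨ +-cong (sym (⊛-at-suc f (dropHead g) M)) refl ⟩
    (f ⊛ dropHead g) (suc M) + f (suc (suc M)) * g 0 ∎

  ⊛-cong : ∀ {f f′ g g′} → f ≋ f′ → g ≋ g′ → f ⊛ g ≋ f′ ⊛ g′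
  ⊛-cong {f} {f′} {g} {g′} f≋ g≋ zero = begin
    (f ⊛ g) 0     ≈⟨ ⊛-at-0 f g ⟩
    f 0 * g 0     ≈⟨ *-cong (f≋ 0) (g≋ 0) ⟩
    f′ 0 * g′ 0   ≈⟨ sym (⊛-at-0 f′ g′) ⟩
    (f′ ⊛ g′) 0   ∎
  ⊛-cong {f} {f′} {g} {g′} f≋ g≋ (suc M) = begin
    (f ⊛ g) (suc M)                          ≈⟨ ⊛-at-suc f g M ⟩
    f 0 * g (suc M) + (dropHead f ⊛ g) M
      ≈⟨ +-cong (*-cong (f≋ 0) (g≋ (suc M))) (⊛-cong (f≋ ∘ suc) g≋ M) ⟩
    f′ 0 * g′ (suc M) + (dropHead f′ ⊛ g′) M ≈⟨ sym (⊛-at-suc f′ g′ M) ⟩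
    (f′ ⊛ g′) (suc M)                        ∎

  ⊛-zeroˡ : ∀ {z} g → z ≋ 0S → z ⊛ g ≋ 0S
  ⊛-zeroˡ {z} g z≋0 zero = begin
    (z ⊛ g) 0   ≈⟨ ⊛-at-0 z g ⟩
    z 0 * g 0   ≈⟨ *-cong (z≋0 0) refl ⟩
    0# * g 0    ≈⟨ zeroˡ _ ⟩
    0#          ∎
  ⊛-zeroˡ {z} g z≋0 (suc M) = begin
    (z ⊛ g) (suc M)                        ≈⟨ ⊛-at-suc z g M ⟩
    z 0 * g (suc M) + (dropHead z ⊛ g) M
      ≈⟨ +-cong (trans (*-cong (z≋0 0) refl) (zeroˡ _)) (⊛-zeroˡ g (z≋0 ∘ suc) M) ⟩
    0# + 0#                                ≈⟨ +-identityˡ _ ⟩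
    0#                                     ∎

  ⊛-comm : ∀ f g → f ⊛ g ≋ g ⊛ f
  ⊛-comm f g zero = begin
    (f ⊛ g) 0   ≈⟨ ⊛-at-0 f g ⟩
    f 0 * g 0   ≈⟨ *-comm _ _ ⟩
    g 0 * f 0   ≈⟨ sym (⊛-at-0 g f) ⟩
    (g ⊛ f) 0   ∎
  ⊛-comm f g (suc M) = begin
    (f ⊛ g) (suc M)                         ≈⟨ ⊛-at-suc f g M ⟩
    f 0 * g (suc M) + (dropHead f ⊛ g) M    ≈⟨ +-cong (*-comm _ _) (⊛-comm (dropHead f) g M) ⟩
    g (suc M) * f 0 + (g ⊛ dropHead f) M    ≈⟨ +-comm _ _ ⟩
    (g ⊛ dropHead f) M + g (suc M) * f 0    ≈⟨ sym (⊛-at-suc′ g f M) ⟩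
    (g ⊛ f) (suc M)                         ∎

  ⊛-distribˡ : ∀ f g h → f ⊛ (g ⊕ h) ≋ f ⊛ g ⊕ f ⊛ h
  ⊛-distribˡ f g h zero = begin
    (f ⊛ (g ⊕ h)) 0           ≈⟨ ⊛-at-0 f (g ⊕ h) ⟩
    f 0 * (g 0 + h 0)         ≈⟨ distribˡ _ _ _ ⟩
    f 0 * g 0 + f 0 * h 0     ≈⟨ sym (+-cong (⊛-at-0 f g) (⊛-at-0 f h)) ⟩
    (f ⊛ g ⊕ f ⊛ h) 0         ∎
  ⊛-distribˡ f g h (suc M) = begin
    (f ⊛ (g ⊕ h)) (suc M)
      ≈⟨ ⊛-at-suc f (g ⊕ h) M ⟩
    f 0 * (g (suc M) + h (suc M)) + (dropHead f ⊛ (g ⊕ h)) M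
      ≈⟨ +-cong (distribˡ _ _ _) (⊛-distribˡ (dropHead f) g h M) ⟩
    (f 0 * g (suc M) + f 0 * h (suc M)) + ((dropHead f ⊛ g) M + (dropHead f ⊛ h) M)
      ≈⟨ interchange _ _ _ _ ⟩
    (f 0 * g (suc M) + (dropHead f ⊛ g) M) + (f 0 * h (suc M) + (dropHead f ⊛ h) M)
      ≈⟨ sym (+-cong (⊛-at-suc f g M) (⊛-at-suc f h M)) ⟩
    (f ⊛ g ⊕ f ⊛ h) (suc M) ∎
    where open import Algebra.Properties.CommutativeSemigroup +-commutativeSemigroup using (interchange)

  ⊛-distribʳ : ∀ h f g → (f ⊕ g) ⊛ h ≋ f ⊛ h ⊕ g ⊛ h
  ⊛-distribʳ h f g N = begin
    ((f ⊕ g) ⊛ h) N         ≈⟨ ⊛-comm (f ⊕ g) h N ⟩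
    (h ⊛ (f ⊕ g)) N         ≈⟨ ⊛-distribˡ h f g N ⟩
    (h ⊛ f) N + (h ⊛ g) N   ≈⟨ +-cong (⊛-comm h f N) (⊛-comm h g N) ⟩
    (f ⊛ h ⊕ g ⊛ h) N       ∎

  ·-⊛ : ∀ c f g → (c · f) ⊛ g ≋ c · (f ⊛ g)
  ·-⊛ c f g zero = begin
    ((c · f) ⊛ g) 0     ≈⟨ ⊛-at-0 (c · f) g ⟩
    (c * f 0) * g 0     ≈⟨ *-assoc _ _ _ ⟩
    c * (f 0 * g 0)     ≈⟨ *-cong refl (sym (⊛-at-0 f g)) ⟩
    (c · (f ⊛ g)) 0     ∎
  ·-⊛ c f g (suc M) = begin
    ((c · f) ⊛ g) (suc M)
      ≈⟨ ⊛-at-suc (c · f) g M ⟩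
    (c * f 0) * g (suc M) + ((c · dropHead f) ⊛ g) M
      ≈⟨ +-cong (*-assoc _ _ _) (·-⊛ c (dropHead f) g M) ⟩
    c * (f 0 * g (suc M)) + c * (dropHead f ⊛ g) M
      ≈⟨ sym (distribˡ _ _ _) ⟩
    c * (f 0 * g (suc M) + (dropHead f ⊛ g) M)
      ≈⟨ *-cong refl (sym (⊛-at-suc f g M)) ⟩
    (c · (f ⊛ g)) (suc M) ∎

  ⊛-assoc : ∀ f g h → (f ⊛ g) ⊛ h ≋ f ⊛ (g ⊛ h)
  ⊛-assoc f g h zero = begin
    ((f ⊛ g) ⊛ h) 0       ≈⟨ ⊛-at-0 (f ⊛ g) h ⟩
    (f ⊛ g) 0 * h 0       ≈⟨ *-cong (⊛-at-0 f g) refl ⟩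
    (f 0 * g 0) * h 0     ≈⟨ *-assoc _ _ _ ⟩
    f 0 * (g 0 * h 0)     ≈⟨ *-cong refl (sym (⊛-at-0 g h)) ⟩
    f 0 * (g ⊛ h) 0       ≈⟨ sym (⊛-at-0 f (g ⊛ h)) ⟩
    (f ⊛ (g ⊛ h)) 0       ∎
  ⊛-assoc f g h (suc M) = begin
    ((f ⊛ g) ⊛ h) (suc M)
      ≈⟨ ⊛-at-suc (f ⊛ g) h M ⟩
    (f ⊛ g) 0 * h (suc M) + (dropHead (f ⊛ g) ⊛ h) M
      ≈⟨ +-cong (*-cong (⊛-at-0 f g) refl) (⊛-cong {g = h} (⊛-at-suc f g) (λ _ → refl) M) ⟩
    (f 0 * g 0) * h (suc M) + ((f 0 · dropHead g ⊕ dropHead f ⊛ g) ⊛ h) M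
      ≈⟨ +-cong (*-assoc _ _ _) (⊛-distribʳ h (f 0 · dropHead g) (dropHead f ⊛ g) M) ⟩
    f 0 * (g 0 * h (suc M)) + (((f 0 · dropHead g) ⊛ h) M + ((dropHead f ⊛ g) ⊛ h) M)
      ≈⟨ +-cong refl (+-cong (·-⊛ (f 0) (dropHead g) h M) (⊛-assoc (dropHead f) g h M)) ⟩
    f 0 * (g 0 * h (suc M)) + (f 0 * (dropHead g ⊛ h) M + (dropHead f ⊛ (g ⊛ h)) M)
      ≈⟨ sym (+-assoc _ _ _) ⟩
    (f 0 * (g 0 * h (suc M)) + f 0 * (dropHead g ⊛ h) M) + (dropHead f ⊛ (g ⊛ h)) M
      ≈⟨ +-cong (sym (distribˡ _ _ _)) refl ⟩
    f 0 * (g 0 * h (suc M) + (dropHead g ⊛ h) M) + (dropHead f ⊛ (g ⊛ h)) M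
      ≈⟨ +-cong (*-cong refl (sym (⊛-at-suc g h M))) refl ⟩
    f 0 * (g ⊛ h) (suc M) + (dropHead f ⊛ (g ⊛ h)) M
      ≈⟨ sym (⊛-at-suc f (g ⊛ h) M) ⟩
    (f ⊛ (g ⊛ h)) (suc M) ∎

  ⊛-identityˡ : ∀ g → 1S ⊛ g ≋ g
  ⊛-identityˡ g zero = trans (⊛-at-0 1S g) (*-identityˡ _)
  ⊛-identityˡ g (suc M) = begin
    (1S ⊛ g) (suc M)                          ≈⟨ ⊛-at-suc 1S g M ⟩
    1# * g (suc M) + (dropHead 1S ⊛ g) M      ≈⟨ +-cong (*-identityˡ _) (⊛-zeroˡ g (λ _ → refl) M) ⟩
    g (suc M) + 0#                            ≈⟨ +-identityʳ _ ⟩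
    g (suc M)                                 ∎

  seqRing : CommutativeRing c ℓ
  seqRing = record
    { Carrier = Seq ; _≈_ = _≋_ ; _+_ = _⊕_ ; _*_ = _⊛_ ; -_ = ⊖_ ; 0# = 0S ; 1# = 1S
    ; isCommutativeRing = record
      { isRing = record
        { +-isAbelianGroup = record
          { isGroup = record
            { isMonoid = record
              { isSemigroup = record
                { isMagma = record
                  { isEquivalence = record
                    { refl = λ _ → refl ; sym = λ e N → sym (e N) ; trans = λ e e′ N → trans (e N) (e′ N) }
                  ; ∙-cong = λ e e′ N → +-cong (e N) (e′ N) }
                ; assoc = λ f g h N → +-assoc (f N) (g N) (h N) }
              ; identity = (λ f N → +-identityˡ (f N)) , (λ f N → +-identityʳ (f N)) }
            ; inverse = (λ f N → -‿inverseˡ (f N)) , (λ f N → -‿inverseʳ (f N))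
            ; ⁻¹-cong = λ e N → -‿cong (e N) }
          ; comm = λ f g N → +-comm (f N) (g N) }
        ; *-cong = ⊛-cong
        ; *-assoc = ⊛-assoc
        ; *-identity = ⊛-identityˡ , (λ g N → trans (⊛-comm g 1S N) (⊛-identityˡ g N))
        ; distrib = ⊛-distribˡ , ⊛-distribʳ }
      ; *-comm = ⊛-comm } }

-- Multiplication in n+1 variables is the
-- Cauchy product, in the first variable, of the coefficient sequences
-- ("slices") in the remaining n variables; so the ring laws are transported
-- from PowerSeries over MPoly n, by induction on n.
module Polynomials where
  open import Level using (0ℓ)
  open import Data.Nat using (ℕ; zero; suc; _∸_)
  open import Data.List using (List; []; _∷_; map; upTo; concatMap; _++_)
  open import Data.List.Properties using (map-++; map-cong)
  open import Data.Vec using ([]; _∷_)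
  open import Data.Product using (_,_; _×_; proj₁; proj₂)
  open import Data.Rational as ℚ using (ℚ; 0ℚ)
  import Data.Rational.Properties as ℚP
  open import Function using (_∘_)
  open import Relation.Binary.PropositionalEquality as P using (_≡_; refl; cong; cong₂)

  infix 4 _≈P_
  _≈P_ : ∀ {n} → MPoly n → MPoly n → Set
  f ≈P g = ∀ e → f e ≡ g e

  sumℚ-++ : ∀ xs ys → sumℚ (xs ++ ys) ≡ sumℚ xs ℚ.+ sumℚ ys
  sumℚ-++ [] ys = P.sym (ℚP.+-identityˡ _)
  sumℚ-++ (x ∷ xs) ys = P.trans (cong (x ℚ.+_) (sumℚ-++ xs ys)) (P.sym (ℚP.+-assoc x _ _))

  sumℚ-map-map : ∀ {A B : Set} (φ : B → ℚ) (θ : A → B) l →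
    sumℚ (map φ (map θ l)) ≡ sumℚ (map (φ ∘ θ) l)
  sumℚ-map-map φ θ [] = refl
  sumℚ-map-map φ θ (x ∷ l) = cong (φ (θ x) ℚ.+_) (sumℚ-map-map φ θ l)

  sumℚ-concatMap : ∀ {A B : Set} (φ : B → ℚ) (ψ : A → List B) l →
    sumℚ (map φ (concatMap ψ l)) ≡ sumℚ (map (λ i → sumℚ (map φ (ψ i))) l)
  sumℚ-concatMap φ ψ [] = refl
  sumℚ-concatMap φ ψ (x ∷ l) = P.trans (cong sumℚ (map-++ φ (ψ x) (concatMap ψ l)))
    (P.trans (sumℚ-++ (map φ (ψ x)) _) (cong (sumℚ (map φ (ψ x)) ℚ.+_) (sumℚ-concatMap φ ψ l)))

  sumP-at : ∀ {n} {A : Set} (H : A → MPoly n) l e → sumP (map H l) e ≡ sumℚ (map (λ i → H i e) l)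
  sumP-at H [] e = refl
  sumP-at H (x ∷ l) e = cong (H x e ℚ.+_) (sumP-at H l e)

  -- the multiplicative laws; the additive ones hold pointwise in ℚ
  record MulLaws (n : ℕ) : Set where
    field
      *P-cong     : ∀ {f f′ g g′ : MPoly n} → f ≈P f′ → g ≈P g′ → (f *P g) ≈P (f′ *P g′)
      *P-assoc    : ∀ (f g h : MPoly n) → ((f *P g) *P h) ≈P (f *P (g *P h))
      *P-comm     : ∀ (f g : MPoly n) → (f *P g) ≈P (g *P f)
      *P-identityˡ : ∀ (g : MPoly n) → (1P *P g) ≈P g
      *P-distribˡ : ∀ (f g h : MPoly n) → (f *P (g +P h)) ≈P ((f *P g) +P (f *P h))

  ringFromMulLaws : ∀ n → MulLaws n → CommutativeRing 0ℓ 0ℓ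
  ringFromMulLaws n laws = record
    { Carrier = MPoly n ; _≈_ = _≈P_ ; _+_ = _+P_ ; _*_ = _*P_ ; -_ = -P_ ; 0# = 0P ; 1# = 1P
    ; isCommutativeRing = record
      { isRing = record
        { +-isAbelianGroup = record
          { isGroup = record
            { isMonoid = record
              { isSemigroup = record
                { isMagma = record
                  { isEquivalence = record
                    { refl = λ _ → refl ; sym = λ e x → P.sym (e x) ; trans = λ e e′ x → P.trans (e x) (e′ x) }
                  ; ∙-cong = λ e e′ x → cong₂ ℚ._+_ (e x) (e′ x) }
                ; assoc = λ f g h x → ℚP.+-assoc (f x) (g x) (h x) }
              ; identity = (λ f x → ℚP.+-identityˡ (f x)) , (λ f x → ℚP.+-identityʳ (f x)) }
            ; inverse = (λ f x → ℚP.+-inverseˡ (f x)) , (λ f x → ℚP.+-inverseʳ (f x))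
            ; ⁻¹-cong = λ e x → cong ℚ.-_ (e x) }
          ; comm = λ f g x → ℚP.+-comm (f x) (g x) }
        ; *-cong = *P-cong
        ; *-assoc = *P-assoc
        ; *-identity = *P-identityˡ , (λ g x → P.trans (*P-comm g 1P x) (*P-identityˡ g x))
        ; distrib = *P-distribˡ , (λ h f g x → P.trans (*P-comm (f +P g) h x)
                     (P.trans (*P-distribˡ h f g x) (cong₂ ℚ._+_ (*P-comm h f x) (*P-comm h g x)))) }
      ; *-comm = *P-comm } }
    where open MulLaws laws

  mulLaws : ∀ n → MulLaws n

  polyRing : ℕ → CommutativeRing 0ℓ 0ℓ
  polyRing n = ringFromMulLaws n (mulLaws n)

  -- no variables: (f *P g) [] = f [] * g [] + 0
  mulLaws zero = record
    { *P-cong = λ { f≈ g≈ [] → cong (ℚ._+ 0ℚ) (cong₂ ℚ._*_ (f≈ []) (g≈ [])) }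
    ; *P-assoc = λ { f g h [] → cong (ℚ._+ 0ℚ) (P.trans (cong (ℚ._* h []) (ℚP.+-identityʳ (f [] ℚ.* g [])))
        (P.trans (ℚP.*-assoc (f []) (g []) (h [])) (cong (f [] ℚ.*_) (P.sym (ℚP.+-identityʳ (g [] ℚ.* h [])))))) }
    ; *P-comm = λ { f g [] → cong (ℚ._+ 0ℚ) (ℚP.*-comm (f []) (g [])) }
    ; *P-identityˡ = λ { g [] → P.trans (ℚP.+-identityʳ _) (ℚP.*-identityˡ _) }
    ; *P-distribˡ = λ { f g h [] → P.trans (ℚP.+-identityʳ _) (P.trans (ℚP.*-distribˡ-+ (f []) (g []) (h []))
        (P.sym (cong₂ ℚ._+_ (ℚP.+-identityʳ (f [] ℚ.* g [])) (ℚP.+-identityʳ (f [] ℚ.* h []))))) }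
    }
  mulLaws (suc n) = record
    { *P-cong = λ {f} {f′} {g} {g′} f≈ g≈ → λ { (x ∷ e) → P.trans (*P-slices f g x e)
        (P.trans (S.⊛-cong {slices f} {slices f′} {slices g} {slices g′}
                   (λ i e → f≈ (i ∷ e)) (λ i e → g≈ (i ∷ e)) x e)
                 (P.sym (*P-slices f′ g′ x e))) }
    ; *P-assoc = λ f g h → λ { (x ∷ e) → P.trans (*P-slices (f *P g) h x e)
        (P.trans (S.⊛-cong {slices (f *P g)} {slices f S.⊛ slices g} {slices h} {slices h}
                   (*P-slices f g) (λ _ _ → refl) x e)
        (P.trans (S.⊛-assoc (slices f) (slices g) (slices h) x e)
        (P.sym (P.trans (*P-slices f (g *P h) x e)
          (S.⊛-cong {slices f} {slices f} {slices (g *P h)} {slices g S.⊛ slices h}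
             (λ _ _ → refl) (*P-slices g h) x e))))) }
    ; *P-comm = λ f g → λ { (x ∷ e) → P.trans (*P-slices f g x e)
        (P.trans (S.⊛-comm (slices f) (slices g) x e) (P.sym (*P-slices g f x e))) }
    ; *P-identityˡ = λ g → λ { (x ∷ e) → P.trans (*P-slices 1P g x e)
        (P.trans (S.⊛-cong {slices 1P} {S.1S} {slices g} {slices g} slices-1P (λ _ _ → refl) x e)
                 (S.⊛-identityˡ (slices g) x e)) }
    ; *P-distribˡ = λ f g h → λ { (x ∷ e) → P.trans (*P-slices f (g +P h) x e)
        (P.trans (S.⊛-distribˡ (slices f) (slices g) (slices h) x e)
                 (P.sym (cong₂ ℚ._+_ (*P-slices f g x e) (*P-slices f h x e)))) }
    }
    where
      module S = PowerSeries (polyRing n)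

      slices : MPoly (suc n) → S.Seq
      slices f i e = f (i ∷ e)

      slices-1P : slices 1P S.≋ S.1S
      slices-1P zero e = refl
      slices-1P (suc i) e = refl

      *P-slices : ∀ f g x e → (f *P g) (x ∷ e) ≡ (slices f S.⊛ slices g) x e
      *P-slices f g x e = P.trans (sumℚ-concatMap term splitsAt (upTo (suc x)))
        (P.trans (cong sumℚ (map-cong (λ i → sumℚ-map-map term (extend i) (splits e)) (upTo (suc x))))
                 (P.sym (sumP-at (λ i → slices f i *P slices g (x ∸ i)) (upTo (suc x)) e)))
        where
          term : Mon (suc n) × Mon (suc n) → ℚ
          term ab = f (proj₁ ab) ℚ.* g (proj₂ ab)
          extend : ℕ → Mon n × Mon n → Mon (suc n) × Mon (suc n)
          extend i ab = (i ∷ proj₁ ab , (x ∸ i) ∷ proj₂ ab)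
          splitsAt : ℕ → List (Mon (suc n) × Mon (suc n))
          splitsAt i = map (extend i) (splits e)

module Degree where
  open import Data.Bool using (true; false; T)
  open import Data.Nat as ℕ using (ℕ; zero; suc; _≡ᵇ_; _<_; s≤s)
  import Data.Nat.Properties as ℕP
  open import Data.Fin using (Fin)
  open import Data.List using (List; []; _∷_; map)
  open import Data.List.Relation.Unary.All as All using (All; []; _∷_)
  import Data.List.Relation.Unary.All.Properties as AllP
  open import Data.Vec as Vec using (Vec; []; _∷_; zipWith; take)
  open import Data.Vec.Properties using (take-zipWith)
  open import Data.Product using (_,_; _×_; proj₁; proj₂)
  open import Data.Empty using (⊥-elim)
  open import Data.Unit using (tt)
  open import Data.Rational as ℚ using (ℚ; 0ℚ)
  import Data.Rational.Properties as ℚP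
  open import Relation.Nullary using (yes; no)
  open import Relation.Binary.PropositionalEquality as P using (_≡_; _≢_; refl; cong; cong₂)
  open import Algebra.Properties.CommutativeSemigroup ℕP.+-commutativeSemigroup using (interchange)
  open Polynomials

  IsSplit : ∀ {n} → Mon n → Mon n × Mon n → Set
  IsSplit e ab = zipWith ℕ._+_ (proj₁ ab) (proj₂ ab) ≡ e

  splits-sound : ∀ {n} (e : Mon n) → All (IsSplit e) (splits e)
  splits-sound [] = refl ∷ []
  splits-sound (x ∷ e) = AllP.concat⁺ (AllP.map⁺ (AllP.applyUpTo⁺₁ (λ i → i) (suc x)
    (λ {i} i<1+x → AllP.map⁺ (All.map (λ eq → cong₂ _∷_ (ℕP.m+[n∸m]≡n (ℕ.s≤s⁻¹ i<1+x)) eq)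
                                      (splits-sound e)))))

  sumℚ-cong-All : ∀ {A : Set} (φ ψ : A → ℚ) {l} → All (λ x → φ x ≡ ψ x) l → sumℚ (map φ l) ≡ sumℚ (map ψ l)
  sumℚ-cong-All φ ψ [] = refl
  sumℚ-cong-All φ ψ (px ∷ pxs) = cong₂ ℚ._+_ px (sumℚ-cong-All φ ψ pxs)

  sumSplits-cong : ∀ {n} (e : Mon n) (φ ψ : Mon n × Mon n → ℚ) →
    (∀ a b → zipWith ℕ._+_ a b ≡ e → φ (a , b) ≡ ψ (a , b)) →
    sumℚ (map φ (splits e)) ≡ sumℚ (map ψ (splits e))
  sumSplits-cong e φ ψ h = sumℚ-cong-All φ ψ (All.map (λ {ab} → h (proj₁ ab) (proj₂ ab)) (splits-sound e))

  sumSplits-zero : ∀ {n} (e : Mon n) (φ : Mon n × Mon n → ℚ) →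
    (∀ a b → zipWith ℕ._+_ a b ≡ e → φ (a , b) ≡ 0ℚ) → sumℚ (map φ (splits e)) ≡ 0ℚ
  sumSplits-zero e φ h = P.trans (sumSplits-cong e φ (λ _ → 0ℚ) h) (sumℚ-zeros (splits e))
    where
      sumℚ-zeros : ∀ {A : Set} (l : List A) → sumℚ (map (λ _ → 0ℚ) l) ≡ 0ℚ
      sumℚ-zeros [] = refl
      sumℚ-zeros (_ ∷ l) = P.trans (cong (0ℚ ℚ.+_) (sumℚ-zeros l)) (ℚP.+-identityˡ 0ℚ)

  sum-zipWith : ∀ {n} (a b : Vec ℕ n) → Vec.sum (zipWith ℕ._+_ a b) ≡ Vec.sum a ℕ.+ Vec.sum b
  sum-zipWith [] [] = refl
  sum-zipWith (x ∷ a) (y ∷ b) =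
    P.trans (cong ((x ℕ.+ y) ℕ.+_) (sum-zipWith a b)) (interchange x y (Vec.sum a) (Vec.sum b))

  sum-split : ∀ {n} {e : Mon n} a b → zipWith ℕ._+_ a b ≡ e → Vec.sum a ℕ.+ Vec.sum b ≡ Vec.sum e
  sum-split a b refl = P.sym (sum-zipWith a b)

  homComp-in : ∀ {n} d (f : MPoly n) e → Vec.sum e ≡ d → homComp d f e ≡ f e
  homComp-in d f e eq with Vec.sum e ≡ᵇ d in test
  ... | true = refl
  ... | false = ⊥-elim (P.subst T test (ℕP.≡⇒≡ᵇ (Vec.sum e) d eq))

  homComp-out : ∀ {n} d (f : MPoly n) e → Vec.sum e ≢ d → homComp d f e ≡ 0ℚ
  homComp-out d f e ne with Vec.sum e ≡ᵇ d in test
  ... | true = ⊥-elim (ne (ℕP.≡ᵇ⇒≡ (Vec.sum e) d (P.subst T (P.sym test) tt)))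
  ... | false = refl

  homComp-zero : ∀ {n} d (f : MPoly n) e → f e ≡ 0ℚ → homComp d f e ≡ 0ℚ
  homComp-zero d f e f≡0 with Vec.sum e ℕ.≟ d
  ... | yes eq = P.trans (homComp-in d f e eq) f≡0
  ... | no ne = homComp-out d f e ne

  Deg : ∀ {n} → ℕ → MPoly n → Set
  Deg d f = ∀ e → d < Vec.sum e → f e ≡ 0ℚ

  zero*ℚ : ∀ {x} y → x ≡ 0ℚ → x ℚ.* y ≡ 0ℚ
  zero*ℚ y refl = ℚP.*-zeroˡ y

  *zeroℚ : ∀ x {y} → y ≡ 0ℚ → x ℚ.* y ≡ 0ℚ
  *zeroℚ x refl = ℚP.*-zeroʳ x

  Deg-*P : ∀ {n} d₁ d₂ (f g : MPoly n) → Deg d₁ f → Deg d₂ g → Deg (d₁ ℕ.+ d₂) (f *P g)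
  Deg-*P d₁ d₂ f g df dg e d<∣e∣ = sumSplits-zero e _ term
    where
      term : ∀ a b → zipWith ℕ._+_ a b ≡ e → f a ℚ.* g b ≡ 0ℚ
      term a b split with d₁ ℕ.<? Vec.sum a | d₂ ℕ.<? Vec.sum b
      ... | yes lt | _ = zero*ℚ (g b) (df a lt)
      ... | no _ | yes lt = *zeroℚ (f a) (dg b lt)
      ... | no ¬a | no ¬b = ⊥-elim (ℕP.<⇒≱ d<∣e∣ (P.subst (ℕ._≤ d₁ ℕ.+ d₂) (sum-split a b split)
                                      (ℕP.+-mono-≤ (ℕP.≮⇒≥ ¬a) (ℕP.≮⇒≥ ¬b))))

  homComp-*P : ∀ {n} d₁ d₂ (f g : MPoly n) → Deg d₁ f → Deg d₂ g →
    homComp (d₁ ℕ.+ d₂) (f *P g) ≈P (homComp d₁ f *P homComp d₂ g)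
  homComp-*P d₁ d₂ f g df dg e with Vec.sum e ℕ.≟ d₁ ℕ.+ d₂
  ... | no ne = P.trans (homComp-out _ (f *P g) e ne) (P.sym (sumSplits-zero e _ term))
    where
      term : ∀ a b → zipWith ℕ._+_ a b ≡ e → homComp d₁ f a ℚ.* homComp d₂ g b ≡ 0ℚ
      term a b split with Vec.sum a ℕ.≟ d₁ | Vec.sum b ℕ.≟ d₂
      ... | yes ea | yes eb = ⊥-elim (ne (P.trans (P.sym (sum-split a b split)) (cong₂ ℕ._+_ ea eb)))
      ... | no na | _ = zero*ℚ (homComp d₂ g b) (homComp-out d₁ f a na)
      ... | yes _ | no nb = *zeroℚ (homComp d₁ f a) (homComp-out d₂ g b nb)
  ... | yes ∣e∣≡d = P.trans (homComp-in _ (f *P g) e ∣e∣≡d) (sumSplits-cong e _ _ term)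
    where
      term : ∀ a b → zipWith ℕ._+_ a b ≡ e → f a ℚ.* g b ≡ homComp d₁ f a ℚ.* homComp d₂ g b
      term a b split with d₁ ℕ.<? Vec.sum a | d₂ ℕ.<? Vec.sum b
      ... | yes lt | _ = P.trans (zero*ℚ (g b) (df a lt))
                                 (P.sym (zero*ℚ (homComp d₂ g b) (homComp-zero d₁ f a (df a lt))))
      ... | no _ | yes lt = P.trans (*zeroℚ (f a) (dg b lt))
                                    (P.sym (*zeroℚ (homComp d₁ f a) (homComp-zero d₂ g b (dg b lt))))
      ... | no ¬a | no ¬b = P.sym (cong₂ ℚ._*_ (homComp-in d₁ f a ∣a∣≡d₁) (homComp-in d₂ g b ∣b∣≡d₂))
        where
          -- |a| ≤ d₁, |b| ≤ d₂ and |a| + |b| = d₁ + d₂ force equality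
          ∣a∣≤d₁ : Vec.sum a ℕ.≤ d₁
          ∣a∣≤d₁ = ℕP.≮⇒≥ ¬a
          ∣b∣≤d₂ : Vec.sum b ℕ.≤ d₂
          ∣b∣≤d₂ = ℕP.≮⇒≥ ¬b
          sum≡ : Vec.sum a ℕ.+ Vec.sum b ≡ d₁ ℕ.+ d₂
          sum≡ = P.trans (sum-split a b split) ∣e∣≡d
          ∣a∣≡d₁ : Vec.sum a ≡ d₁
          ∣a∣≡d₁ = ℕP.≤-antisym ∣a∣≤d₁ (ℕP.+-cancelʳ-≤ (Vec.sum b) d₁ (Vec.sum a)
                     (P.subst (d₁ ℕ.+ Vec.sum b ℕ.≤_) (P.sym sum≡) (ℕP.+-monoʳ-≤ d₁ ∣b∣≤d₂)))
          ∣b∣≡d₂ : Vec.sum b ≡ d₂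
          ∣b∣≡d₂ = ℕP.≤-antisym ∣b∣≤d₂ (ℕP.+-cancelˡ-≤ (Vec.sum a) d₂ (Vec.sum b)
                     (P.subst (Vec.sum a ℕ.+ d₂ ℕ.≤_) (P.sym sum≡) (ℕP.+-monoˡ-≤ d₂ ∣a∣≤d₁)))

  Deg-mono : ∀ {n d d′} {f : MPoly n} → d ℕ.≤ d′ → Deg d f → Deg d′ f
  Deg-mono d≤d′ df e lt = df e (ℕP.≤-<-trans d≤d′ lt)

  Deg-1P : ∀ {n} → Deg {n} 0 1P
  Deg-1P (zero ∷ e) lt = Deg-1P e lt
  Deg-1P (suc _ ∷ e) lt = refl

  Deg-0P : ∀ {n d} → Deg {n} d 0P
  Deg-0P e lt = refl

  Deg-+P : ∀ {n d} {f g : MPoly n} → Deg d f → Deg d g → Deg d (f +P g)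
  Deg-+P df dg e lt = P.trans (cong₂ ℚ._+_ (df e lt) (dg e lt)) (ℚP.+-identityˡ 0ℚ)

  Deg--P : ∀ {n d} {f : MPoly n} → Deg d f → Deg d (-P f)
  Deg--P df e lt = cong ℚ.-_ (df e lt)

  Deg-cst : ∀ {n} c → Deg {n} 0 (cst c)
  Deg-cst c e lt = *zeroℚ c (Deg-1P e lt)

  Deg-var : ∀ {n} (i : Fin n) → Deg 1 (var i)
  Deg-var Fin.zero (zero ∷ e) lt = refl
  Deg-var Fin.zero (suc zero ∷ e) (s≤s lt) = Deg-1P e lt
  Deg-var Fin.zero (suc (suc _) ∷ e) lt = refl
  Deg-var (Fin.suc i) (zero ∷ e) lt = Deg-var i e lt
  Deg-var (Fin.suc i) (suc _ ∷ e) lt = refl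

  Deg-^P : ∀ {n} (c : MPoly n) → Deg 1 c → ∀ N → Deg N (c ^P N)
  Deg-^P c dc zero = Deg-1P
  Deg-^P c dc (suc N) = Deg-*P 1 N c (c ^P N) dc (Deg-^P c dc N)

  -- the substitution p ↦ -p multiplies the coefficient of p^α q^β by (-1)^|α|;
  -- |α| is additive along splits, so negP is multiplicative
  signℚ-+ : ∀ x y → signℚ (x ℕ.+ y) ≡ signℚ x ℚ.* signℚ y
  signℚ-+ zero y = P.sym (ℚP.*-identityˡ _)
  signℚ-+ (suc x) y = P.trans (cong ℚ.-_ (signℚ-+ x y)) (ℚP.neg-distribˡ-* (signℚ x) (signℚ y))

  sumℚ-scale : ∀ {A : Set} c (φ : A → ℚ) l → c ℚ.* sumℚ (map φ l) ≡ sumℚ (map (λ x → c ℚ.* φ x) l)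
  sumℚ-scale c φ [] = ℚP.*-zeroʳ c
  sumℚ-scale c φ (x ∷ l) = P.trans (ℚP.*-distribˡ-+ c (φ x) _) (cong (c ℚ.* φ x ℚ.+_) (sumℚ-scale c φ l))

  module _ (m : ℕ) where

    pDegree : Mon (m ℕ.+ m) → ℕ
    pDegree e = Vec.sum (take m e)

    pDegree-split : ∀ {e : Mon (m ℕ.+ m)} a b → zipWith ℕ._+_ a b ≡ e → pDegree a ℕ.+ pDegree b ≡ pDegree e
    pDegree-split a b refl = P.sym (P.trans (cong Vec.sum (take-zipWith {m = m} ℕ._+_ a b))
                                            (sum-zipWith (take m a) (take m b)))

    negP-*P : ∀ (f g : MPoly (m ℕ.+ m)) → negP m (f *P g) ≈P (negP m f *P negP m g)
    negP-*P f g e = P.trans (sumℚ-scale (signℚ (pDegree e)) _ (splits e)) (sumSplits-cong e _ _ term)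
      where
        open import Algebra.Bundles using (CommutativeRing)
        open import Algebra.Properties.CommutativeSemigroup
          (CommutativeRing.*-commutativeSemigroup ℚP.+-*-commutativeRing) renaming (interchange to *-interchange)
        term : ∀ a b → zipWith ℕ._+_ a b ≡ e →
          signℚ (pDegree e) ℚ.* (f a ℚ.* g b) ≡ (signℚ (pDegree a) ℚ.* f a) ℚ.* (signℚ (pDegree b) ℚ.* g b)
        term a b split = P.trans
          (cong (ℚ._* (f a ℚ.* g b))
                (P.trans (cong signℚ (P.sym (pDegree-split a b split))) (signℚ-+ (pDegree a) (pDegree b))))
          (*-interchange (signℚ (pDegree a)) (signℚ (pDegree b)) (f a) (g b))

module SeriesIdentities {c ℓ} (R : CommutativeRing c ℓ) where
  open import Data.Nat using (zero; suc)

  open CommutativeRing R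
  open import Algebra.Properties.Ring ring using (-‿distribˡ-*; -‿involutive)
  open import Relation.Binary.Reasoning.Setoid setoid
  open PowerSeries R

  oneMinus : Carrier → Seq
  oneMinus b zero = 1#
  oneMinus b (suc zero) = - b
  oneMinus b (suc (suc _)) = 0#

  geometric : Carrier → Seq
  geometric b zero = 1#
  geometric b (suc N) = b * geometric b N

  constS : Carrier → Seq
  constS d zero = d
  constS d (suc _) = 0#

  constS-⊛ : ∀ d f N → (constS d ⊛ f) N ≈ d * f N
  constS-⊛ d f zero = ⊛-at-0 (constS d) f
  constS-⊛ d f (suc M) = begin
    (constS d ⊛ f) (suc M)                            ≈⟨ ⊛-at-suc (constS d) f M ⟩
    d * f (suc M) + (dropHead (constS d) ⊛ f) M        ≈⟨ +-cong refl (⊛-zeroˡ f (λ _ → refl) M) ⟩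
    d * f (suc M) + 0#                                ≈⟨ +-identityʳ _ ⟩
    d * f (suc M)                                     ∎

  oneMinus-⊛-0 : ∀ b f → (oneMinus b ⊛ f) 0 ≈ f 0
  oneMinus-⊛-0 b f = trans (⊛-at-0 (oneMinus b) f) (*-identityˡ _)

  oneMinus-⊛-suc : ∀ b f M → (oneMinus b ⊛ f) (suc M) ≈ f (suc M) + - b * f M
  oneMinus-⊛-suc b f M = begin
    (oneMinus b ⊛ f) (suc M)                          ≈⟨ ⊛-at-suc (oneMinus b) f M ⟩
    1# * f (suc M) + (dropHead (oneMinus b) ⊛ f) M
      ≈⟨ +-cong (*-identityˡ _) (⊛-cong {dropHead (oneMinus b)} {constS (- b)} {f} {f}
                                   (λ { zero → refl ; (suc _) → refl }) (λ _ → refl) M) ⟩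
    f (suc M) + (constS (- b) ⊛ f) M                  ≈⟨ +-cong refl (constS-⊛ (- b) f M) ⟩
    f (suc M) + - b * f M                             ∎

  -x*y+x*y : ∀ x y → - x * y + x * y ≈ 0#
  -x*y+x*y x y = trans (+-cong (sym (-‿distribˡ-* x y)) refl) (-‿inverseˡ _)

  oneMinus-geometric : ∀ b → oneMinus b ⊛ geometric b ≋ 1S
  oneMinus-geometric b zero = oneMinus-⊛-0 b (geometric b)
  oneMinus-geometric b (suc M) =
    trans (oneMinus-⊛-suc b (geometric b) M) (trans (+-comm _ _) (-x*y+x*y b (geometric b M)))

  -- The series  (1 - q t)(1 + q t) / ((1 - a t)(1 + a t))
  --   = 1 + (a² - q²) (t² + a² t⁴ + a⁴ t⁶ + …).
  module Quotient (a q : Carrier) where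
    a²-q² : Carrier
    a²-q² = a * a + - (q * q)

    evenPowers : Seq
    evenPowers zero = 1#
    evenPowers (suc zero) = 0#
    evenPowers (suc (suc N)) = (a * a) * evenPowers N

    quotient : Seq
    quotient zero = 1#
    quotient (suc zero) = 0#
    quotient (suc (suc N)) = a²-q² * evenPowers N

    W : Seq
    W = oneMinus (- a) ⊛ quotient

    W-0 : W 0 ≈ 1#
    W-0 = oneMinus-⊛-0 (- a) quotient

    W-suc : ∀ M → W (suc M) ≈ quotient (suc M) + a * quotient M
    W-suc M = trans (oneMinus-⊛-suc (- a) quotient M) (+-cong refl (*-cong (-‿involutive a) refl))

    cancel-middle : ∀ x y z → (x + a * y) + - a * (y + a * z) ≈ x + - ((a * a) * z)
    cancel-middle x y z = begin
      (x + a * y) + - a * (y + a * z)             ≈⟨ +-cong refl (distribˡ _ _ _) ⟩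
      (x + a * y) + (- a * y + - a * (a * z))     ≈⟨ +-assoc _ _ _ ⟩
      x + (a * y + (- a * y + - a * (a * z)))     ≈⟨ +-cong refl (sym (+-assoc _ _ _)) ⟩
      x + ((a * y + - a * y) + - a * (a * z))     ≈⟨ +-cong refl (+-cong (trans (+-comm _ _) (-x*y+x*y a y)) refl) ⟩
      x + (0# + - a * (a * z))                    ≈⟨ +-cong refl (+-identityˡ _) ⟩
      x + - a * (a * z)                           ≈⟨ +-cong refl (trans (sym (-‿distribˡ-* _ _)) (-‿cong (sym (*-assoc _ _ _)))) ⟩
      x + - ((a * a) * z)                         ∎

    denominator-⊛-quotient : ∀ M → (oneMinus a ⊛ W) (suc (suc M)) ≈ quotient (suc (suc M)) + - ((a * a) * quotient M)
    denominator-⊛-quotient M = begin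
      (oneMinus a ⊛ W) (suc (suc M))                ≈⟨ oneMinus-⊛-suc a W (suc M) ⟩
      W (suc (suc M)) + - a * W (suc M)             ≈⟨ +-cong (W-suc (suc M)) (*-cong refl (W-suc M)) ⟩
      (quotient (suc (suc M)) + a * quotient (suc M)) + - a * (quotient (suc M) + a * quotient M)
                                                    ≈⟨ cancel-middle _ _ _ ⟩
      quotient (suc (suc M)) + - ((a * a) * quotient M) ∎

    quotient-recurrence : ∀ M → quotient (suc (suc (suc M))) + - ((a * a) * quotient (suc M)) ≈ 0#
    quotient-recurrence zero = begin
      a²-q² * 0# + - ((a * a) * 0#)   ≈⟨ +-cong (zeroʳ _) (-‿cong (zeroʳ _)) ⟩
      0# + - 0#                       ≈⟨ -‿inverseʳ 0# ⟩
      0#                              ∎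
    quotient-recurrence (suc M) = trans
      (+-cong (trans (sym (*-assoc _ _ _)) (trans (*-cong (*-comm _ _) refl) (*-assoc _ _ _))) refl)
      (-‿inverseʳ _)

    quotient-equation : ∀ N → (oneMinus a ⊛ W) N ≈ (oneMinus q ⊛ oneMinus (- q)) N
    quotient-equation zero = trans (oneMinus-⊛-0 a W) (trans W-0 (sym (oneMinus-⊛-0 q (oneMinus (- q)))))
    quotient-equation (suc zero) = begin
      (oneMinus a ⊛ W) 1                  ≈⟨ oneMinus-⊛-suc a W 0 ⟩
      W 1 + - a * W 0                     ≈⟨ +-cong (W-suc 0) (*-cong refl W-0) ⟩
      (0# + a * 1#) + - a * 1#            ≈⟨ +-cong (+-identityˡ _) refl ⟩
      a * 1# + - a * 1#                   ≈⟨ trans (+-comm _ _) (-x*y+x*y a 1#) ⟩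
      0#                                  ≈⟨ sym (trans (+-cong (trans (-‿involutive q) (sym (*-identityʳ q))) refl)
                                                        (trans (+-comm _ _) (-x*y+x*y q 1#))) ⟩
      - - q + - q * 1#                    ≈⟨ sym (oneMinus-⊛-suc q (oneMinus (- q)) 0) ⟩
      (oneMinus q ⊛ oneMinus (- q)) 1     ∎
    quotient-equation (suc (suc zero)) = begin
      (oneMinus a ⊛ W) 2                        ≈⟨ denominator-⊛-quotient 0 ⟩
      a²-q² * 1# + - ((a * a) * 1#)             ≈⟨ +-cong (*-identityʳ _) (-‿cong (*-identityʳ _)) ⟩
      (a * a + - (q * q)) + - (a * a)           ≈⟨ trans (+-cong (+-comm _ _) refl) (+-assoc _ _ _) ⟩
      - (q * q) + (a * a + - (a * a))           ≈⟨ +-cong refl (-‿inverseʳ _) ⟩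
      - (q * q) + 0#                            ≈⟨ +-identityʳ _ ⟩
      - (q * q)                                 ≈⟨ sym (trans (+-identityˡ _) (trans (*-cong refl (-‿involutive q))
                                                                              (sym (-‿distribˡ-* q q)))) ⟩
      0# + - q * - - q                          ≈⟨ sym (oneMinus-⊛-suc q (oneMinus (- q)) 1) ⟩
      (oneMinus q ⊛ oneMinus (- q)) 2           ∎
    quotient-equation (suc (suc (suc M))) = begin
      (oneMinus a ⊛ W) (suc (suc (suc M)))      ≈⟨ denominator-⊛-quotient (suc M) ⟩
      quotient (suc (suc (suc M))) + - ((a * a) * quotient (suc M))
                                                ≈⟨ quotient-recurrence M ⟩
      0#                                        ≈⟨ sym (trans (+-identityˡ _) (zeroʳ _)) ⟩
      0# + - q * 0#                             ≈⟨ sym (oneMinus-⊛-suc q (oneMinus (- q)) (suc (suc M))) ⟩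
      (oneMinus q ⊛ oneMinus (- q)) (suc (suc (suc M))) ∎

module QuotientExpansion {c ℓ} (R : CommutativeRing c ℓ) where

  open CommutativeRing R using (-_; sym)
  open PowerSeries R
  open SeriesIdentities R
  module SR = CommutativeRing seqRing
  open import Relation.Binary.Reasoning.Setoid SR.setoid

  numerator-⊛-geometrics : ∀ a q →
    oneMinus q ⊛ (oneMinus (- q) ⊛ (geometric a ⊛ geometric (- a))) ≋ Quotient.quotient a q
  numerator-⊛-geometrics a q = begin
    oneMinus q ⊛ (oneMinus (- q) ⊛ (geometric a ⊛ geometric (- a)))
      ≈⟨ SR.sym (SR.*-assoc (oneMinus q) (oneMinus (- q)) (geometric a ⊛ geometric (- a))) ⟩
    (oneMinus q ⊛ oneMinus (- q)) ⊛ (geometric a ⊛ geometric (- a))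
      ≈⟨ SR.*-cong {oneMinus q ⊛ oneMinus (- q)} {oneMinus a ⊛ (oneMinus (- a) ⊛ Q)}
           (λ N → sym (Quotient.quotient-equation a q N)) (SR.refl {geometric a ⊛ geometric (- a)}) ⟩
    (oneMinus a ⊛ (oneMinus (- a) ⊛ Q)) ⊛ (geometric a ⊛ geometric (- a))
      ≈⟨ regroup (oneMinus a) (oneMinus (- a)) Q (geometric a) (geometric (- a)) ⟩
    Q ⊛ ((oneMinus a ⊛ geometric a) ⊛ (oneMinus (- a) ⊛ geometric (- a)))
      ≈⟨ SR.*-cong (SR.refl {Q}) (SR.*-cong (oneMinus-geometric a) (oneMinus-geometric (- a))) ⟩
    Q ⊛ (1S ⊛ 1S)
      ≈⟨ SR.trans (SR.*-cong (SR.refl {Q}) (SR.*-identityˡ 1S)) (SR.*-identityʳ Q) ⟩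
    Q ∎
    where
      Q : Seq
      Q = Quotient.quotient a q
      open import Algebra.Solver.CommutativeMonoid SR.*-commutativeMonoid using (solve; _⊜_) renaming (_⊕_ to _⊙_)
      regroup : ∀ x y v g h → (x ⊛ (y ⊛ v)) ⊛ (g ⊛ h) ≋ v ⊛ ((x ⊛ g) ⊛ (y ⊛ h))
      regroup = solve 5 (λ x y v g h → (x ⊙ (y ⊙ v)) ⊙ (g ⊙ h) ⊜ v ⊙ ((x ⊙ g) ⊙ (y ⊙ h))) SR.refl

module Nonnegativity where
  open import Data.Nat as ℕ using (zero; suc)
  open import Data.Fin using (Fin)
  open import Data.List using ([]; _∷_; map)
  open import Data.Vec as Vec using ([]; _∷_)
  open import Data.Product using (proj₁; proj₂)
  open import Data.Rational as ℚ using (ℚ; 0ℚ; 1ℚ)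
  import Data.Rational.Properties as ℚP
  open import Relation.Binary.PropositionalEquality as P using (cong₂)
  open Polynomials

  NN : ∀ {n} → MPoly n → Set
  NN f = ∀ e → 0ℚ ℚ.≤ f e

  0≤* : ∀ {x y} → 0ℚ ℚ.≤ x → 0ℚ ℚ.≤ y → 0ℚ ℚ.≤ x ℚ.* y
  0≤* {x} {y} 0≤x 0≤y = ℚP.nonNegative⁻¹ (x ℚ.* y)
    {{ℚP.nonNeg*nonNeg⇒nonNeg x {{ℚ.nonNegative 0≤x}} y {{ℚ.nonNegative 0≤y}}}}

  NN-resp : ∀ {n} {f g : MPoly n} → f ≈P g → NN f → NN g
  NN-resp f≈g nf e = P.subst (0ℚ ℚ.≤_) (f≈g e) (nf e)

  NN-0P : ∀ {n} → NN (0P {n})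
  NN-0P e = ℚP.≤-refl

  NN-1P : ∀ {n} → NN (1P {n})
  NN-1P [] = ℚP.nonNegative⁻¹ 1ℚ
  NN-1P (zero ∷ e) = NN-1P e
  NN-1P (suc _ ∷ e) = ℚP.≤-refl

  NN-var : ∀ {n} (i : Fin n) → NN (var i)
  NN-var Fin.zero (zero ∷ e) = ℚP.≤-refl
  NN-var Fin.zero (suc zero ∷ e) = NN-1P e
  NN-var Fin.zero (suc (suc _) ∷ e) = ℚP.≤-refl
  NN-var (Fin.suc i) (zero ∷ e) = NN-var i e
  NN-var (Fin.suc i) (suc _ ∷ e) = ℚP.≤-refl

  NN-+P : ∀ {n} {f g : MPoly n} → NN f → NN g → NN (f +P g)
  NN-+P nf ng e = ℚP.+-mono-≤ (nf e) (ng e)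

  NN-sumℚ : ∀ {A : Set} (φ : A → ℚ) l → (∀ x → 0ℚ ℚ.≤ φ x) → 0ℚ ℚ.≤ sumℚ (map φ l)
  NN-sumℚ φ [] nφ = ℚP.≤-refl
  NN-sumℚ φ (x ∷ l) nφ = ℚP.+-mono-≤ (nφ x) (NN-sumℚ φ l nφ)

  NN-*P : ∀ {n} {f g : MPoly n} → NN f → NN g → NN (f *P g)
  NN-*P nf ng e = NN-sumℚ _ (splits e) (λ ab → 0≤* (nf (proj₁ ab)) (ng (proj₂ ab)))

  NN-sumP : ∀ {n} {A : Set} (h : A → MPoly n) l → (∀ x → NN (h x)) → NN (sumP (map h l))
  NN-sumP h [] nh = NN-0P
  NN-sumP h (x ∷ l) nh = NN-+P (nh x) (NN-sumP h l nh)

module LeadingPart (m : ℕ) where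
  open import Data.Nat as ℕ using (ℕ; zero; suc; s≤s; z≤n)
  import Data.Nat.Properties as ℕP
  open import Data.Fin using (Fin; _↑ˡ_; _↑ʳ_)
  open import Data.List using ([]; _∷_; map)
  open import Data.Vec as Vec using (Vec; _∷_; take)
  open import Data.Sum using (_⊎_; inj₁; inj₂)
  open import Data.Empty using (⊥-elim)
  open import Data.Rational as ℚ using (ℚ; 0ℚ; 1ℚ)
  import Data.Rational.Properties as ℚP
  open import Relation.Nullary using (yes; no)
  open import Relation.Binary.PropositionalEquality as P using (_≡_; _≢_; refl; cong; cong₂)
  open Polynomials
  open Degree

  lead : ℕ → MPoly (m ℕ.+ m) → MPoly (m ℕ.+ m)
  lead d f = negP m (homComp d f)

  sign : Mon (m ℕ.+ m) → ℚ
  sign e = signℚ (pDegree m e)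

  lead-cases : ∀ d (e : Mon (m ℕ.+ m)) →
    (∀ f → lead d f e ≡ sign e ℚ.* f e) ⊎ (∀ f → lead d f e ≡ 0ℚ)
  lead-cases d e with Vec.sum e ℕ.≟ d
  ... | yes ∣e∣≡d = inj₁ (λ f → cong (sign e ℚ.*_) (homComp-in d f e ∣e∣≡d))
  ... | no ∣e∣≢d = inj₂ (λ f → P.trans (cong (sign e ℚ.*_) (homComp-out d f e ∣e∣≢d)) (ℚP.*-zeroʳ (sign e)))

  lead-+P : ∀ d f g → lead d (f +P g) ≈P (lead d f +P lead d g)
  lead-+P d f g e with lead-cases d e
  ... | inj₁ h = P.trans (h (f +P g)) (P.trans (ℚP.*-distribˡ-+ (sign e) (f e) (g e)) (P.sym (cong₂ ℚ._+_ (h f) (h g))))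
  ... | inj₂ h = P.trans (h (f +P g)) (P.sym (P.trans (cong₂ ℚ._+_ (h f) (h g)) (ℚP.+-identityˡ 0ℚ)))

  lead--P : ∀ d f → lead d (-P f) ≈P (-P lead d f)
  lead--P d f e with lead-cases d e
  ... | inj₁ h = P.trans (h (-P f)) (P.trans (P.sym (ℚP.neg-distribʳ-* (sign e) (f e))) (cong ℚ.-_ (P.sym (h f))))
  ... | inj₂ h = P.trans (h (-P f)) (cong ℚ.-_ (P.sym (h f)))

  lead-0P : ∀ d → lead d 0P ≈P 0P
  lead-0P d e with lead-cases d e
  ... | inj₁ h = P.trans (h 0P) (ℚP.*-zeroʳ (sign e))
  ... | inj₂ h = h 0P

  lead-scale : ∀ d c f → lead d (scale c f) ≈P scale c (lead d f)
  lead-scale d c f e with lead-cases d e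
  ... | inj₁ h = P.trans (h (scale c f)) (P.trans (P.sym (ℚP.*-assoc (sign e) c (f e)))
                   (P.trans (cong (ℚ._* f e) (ℚP.*-comm (sign e) c)) (P.trans (ℚP.*-assoc c (sign e) (f e))
                   (cong (c ℚ.*_) (P.sym (h f))))))
  ... | inj₂ h = P.trans (h (scale c f)) (P.sym (P.trans (cong (c ℚ.*_) (h f)) (ℚP.*-zeroʳ c)))

  lead-sumP : ∀ {A : Set} d (h : A → MPoly (m ℕ.+ m)) l → lead d (sumP (map h l)) ≈P sumP (map (λ x → lead d (h x)) l)
  lead-sumP d h [] = lead-0P d
  lead-sumP d h (x ∷ l) e = P.trans (lead-+P d (h x) (sumP (map h l)) e) (cong (lead d (h x) e ℚ.+_) (lead-sumP d h l e))

  lead-*P : ∀ i j {N} (f g : MPoly (m ℕ.+ m)) → Deg i f → Deg j g → i ℕ.+ j ≡ N →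
    lead N (f *P g) ≈P (lead i f *P lead j g)
  lead-*P i j f g df dg refl e =
    P.trans (cong (sign e ℚ.*_) (homComp-*P i j f g df dg e)) (negP-*P m (homComp i f) (homComp j g) e)

  sum-take-≤ : ∀ k {l} (e : Vec ℕ (k ℕ.+ l)) → Vec.sum (take k e) ℕ.≤ Vec.sum e
  sum-take-≤ zero e = z≤n
  sum-take-≤ (suc k) (x ∷ e) = ℕP.+-monoʳ-≤ x (sum-take-≤ k e)

  -- a polynomial of degree 0 is its own leading part of degree 0 (there |α| = 0)
  lead-of-Deg0 : ∀ f → Deg 0 f → lead 0 f ≈P f
  lead-of-Deg0 f df e with Vec.sum e ℕ.≟ 0
  ... | yes ∣e∣≡0 = P.trans (cong₂ (λ j x → signℚ j ℚ.* x) pDegree≡0 (homComp-in 0 f e ∣e∣≡0)) (ℚP.*-identityˡ (f e))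
    where
      pDegree≡0 : pDegree m e ≡ 0
      pDegree≡0 = ℕP.n≤0⇒n≡0 (P.subst (pDegree m e ℕ.≤_) ∣e∣≡0 (sum-take-≤ m e))
  ... | no ∣e∣≢0 = P.trans (*zeroℚ (sign e) (homComp-out 0 f e ∣e∣≢0)) (P.sym (df e (ℕP.n≢0⇒n>0 ∣e∣≢0)))

  lead-above-Deg : ∀ d f → Deg d f → lead (suc d) f ≈P 0P
  lead-above-Deg d f df e with Vec.sum e ℕ.≟ suc d
  ... | yes ∣e∣≡1+d = *zeroℚ (sign e) (P.trans (homComp-in (suc d) f e ∣e∣≡1+d)
                        (df e (P.subst (d ℕ.<_) (P.sym ∣e∣≡1+d) ℕP.≤-refl)))
  ... | no ∣e∣≢1+d = *zeroℚ (sign e) (homComp-out (suc d) f e ∣e∣≢1+d)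

  var-of-degree0 : ∀ {n} (i : Fin n) e → Vec.sum e ≡ 0 → var i e ≡ 0ℚ
  var-of-degree0 Fin.zero (zero ∷ e) ∣e∣≡0 = refl
  var-of-degree0 (Fin.suc i) (zero ∷ e) ∣e∣≡0 = var-of-degree0 i e ∣e∣≡0

  var-outside-degree1 : ∀ {n} (i : Fin n) e → Vec.sum e ≢ 1 → var i e ≡ 0ℚ
  var-outside-degree1 i e ∣e∣≢1 with Vec.sum e in ∣e∣
  ... | zero = var-of-degree0 i e ∣e∣
  ... | suc zero = ⊥-elim (∣e∣≢1 refl)
  ... | suc (suc _) = Deg-var i e (P.subst (1 ℕ.<_) (P.sym ∣e∣) (s≤s (s≤s z≤n)))

  lead-var : ∀ j s → (∀ e → var j e ≡ 0ℚ ⊎ sign e ≡ s) → lead 1 (var j) ≈P scale s (var j)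
  lead-var j s support e with Vec.sum e ℕ.≟ 1 | support e
  ... | no ∣e∣≢1 | _ = P.trans (*zeroℚ (sign e) (homComp-out 1 (var j) e ∣e∣≢1))
                          (P.sym (*zeroℚ s (var-outside-degree1 j e ∣e∣≢1)))
  ... | yes ∣e∣≡1 | inj₁ v≡0 = P.trans (*zeroℚ (sign e) (P.trans (homComp-in 1 (var j) e ∣e∣≡1) v≡0))
                                  (P.sym (*zeroℚ s v≡0))
  ... | yes ∣e∣≡1 | inj₂ sign≡s = cong₂ ℚ._*_ sign≡s (homComp-in 1 (var j) e ∣e∣≡1)

  p-support : ∀ {k l} (i : Fin k) (e : Vec ℕ (k ℕ.+ l)) → var (i ↑ˡ l) e ≡ 0ℚ ⊎ Vec.sum (take k e) ≡ 1
  p-support {suc k} Fin.zero (zero ∷ e) = inj₁ refl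
  p-support {suc k} Fin.zero (suc zero ∷ e) with Vec.sum e ℕ.≟ 0
  ... | yes ∣e∣≡0 = inj₂ (cong suc (ℕP.n≤0⇒n≡0 (P.subst (Vec.sum (take k e) ℕ.≤_) ∣e∣≡0 (sum-take-≤ k e))))
  ... | no ∣e∣≢0 = inj₁ (Deg-1P e (ℕP.n≢0⇒n>0 ∣e∣≢0))
  p-support {suc k} Fin.zero (suc (suc _) ∷ e) = inj₁ refl
  p-support {suc k} (Fin.suc i) (zero ∷ e) = p-support i e
  p-support {suc k} (Fin.suc i) (suc _ ∷ e) = inj₁ refl

  q-support : ∀ k {l} (i : Fin l) (e : Vec ℕ (k ℕ.+ l)) → var (k ↑ʳ i) e ≡ 0ℚ ⊎ Vec.sum (take k e) ≡ 0
  q-support zero i e = inj₂ refl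
  q-support (suc k) i (zero ∷ e) = q-support k i e
  q-support (suc k) i (suc _ ∷ e) = inj₁ refl

  lead-q : ∀ i → lead 1 (qV m i) ≈P qV m i
  lead-q i e = P.trans (lead-var (m ↑ʳ i) 1ℚ (λ e → Data.Sum.map₂ (cong signℚ) (q-support m i e)) e)
                       (ℚP.*-identityˡ (qV m i e))

  lead-p : ∀ i → lead 1 (pV m i) ≈P (-P pV m i)
  lead-p i e = P.trans (lead-var (i ↑ˡ m) (ℚ.- 1ℚ) (λ e → Data.Sum.map₂ (cong signℚ) (p-support i e)) e)
                       (P.trans (P.sym (ℚP.neg-distribˡ-* 1ℚ (pV m i e))) (cong ℚ.-_ (ℚP.*-identityˡ (pV m i e))))

module LeadingSeries (m : ℕ) where
  open import Data.Nat as ℕ using (ℕ; zero; suc; _∸_; _<_; s≤s; z≤n)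
  import Data.Nat.Properties as ℕP
  open import Data.Fin using (Fin; _↑ˡ_; _↑ʳ_)
  open import Data.List using (List; []; _∷_; map; foldr; upTo; allFin)
  open import Data.Product using (_,_; _×_; proj₁; proj₂)
  open import Data.Integer using (+_)
  open import Data.Rational as ℚ using (ℚ)
  import Data.Rational.Properties as ℚP
  open import Function using (_∘_)
  open import Relation.Binary.PropositionalEquality as P using (_≡_; refl; cong; cong₂)
  open Polynomials
  open Degree
  open Nonnegativity

  open LeadingPart m

  PolyRing : CommutativeRing _ _
  PolyRing = polyRing (m ℕ.+ m)

  module PR = CommutativeRing PolyRing
  open PowerSeries PolyRing
  module SR = CommutativeRing seqRing
  open SeriesIdentities PolyRing
  open QuotientExpansion PolyRing using (numerator-⊛-geometrics)

  Bounded : Seq → Set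
  Bounded A = ∀ N → Deg N (A N)

  leadS : Seq → Seq
  leadS A N = lead N (A N)

  Deg-sumBelow : ∀ d k h → (∀ i → i < k → Deg d (h i)) → Deg d (sumBelow k h)
  Deg-sumBelow d zero h dh = Deg-0P
  Deg-sumBelow d (suc k) h dh = P.subst (Deg d) (P.sym (sumBelow-suc k h))
    (Deg-+P (dh 0 (s≤s z≤n)) (Deg-sumBelow d k (h ∘ suc) (λ i i<k → dh (suc i) (s≤s i<k))))

  Bounded-⊛ : ∀ A B → Bounded A → Bounded B → Bounded (A ⊛ B)
  Bounded-⊛ A B bA bB N = Deg-sumBelow N (suc N) (λ i → A i *P B (N ∸ i))
    (λ i i≤N → P.subst (λ d → Deg d (A i *P B (N ∸ i))) (ℕP.m+[n∸m]≡n (ℕ.s≤s⁻¹ i≤N))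
                 (Deg-*P i (N ∸ i) (A i) (B (N ∸ i)) (bA i) (bB (N ∸ i))))

  leadS-⊛ : ∀ A B → Bounded A → Bounded B → leadS (A ⊛ B) ≋ leadS A ⊛ leadS B
  leadS-⊛ A B bA bB N e = P.trans (lead-sumP N (λ i → A i *P B (N ∸ i)) (upTo (suc N)) e)
    (sumBelow-cong (suc N) (λ i i≤N → lead-*P i (N ∸ i) (A i) (B (N ∸ i)) (bA i) (bB (N ∸ i))
                                        (ℕP.m+[n∸m]≡n (ℕ.s≤s⁻¹ i≤N))) e)

  BoundedL : Lau (m ℕ.+ m) → Set
  BoundedL A = Bounded (ser A)

  leadL : Lau (m ℕ.+ m) → Seq
  leadL A = leadS (ser A)

  BoundedL-*L : ∀ A B → BoundedL A → BoundedL B → BoundedL (A *L B)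
  BoundedL-*L (lau _ f) (lau _ g) = Bounded-⊛ f g

  leadL-*L : ∀ A B → BoundedL A → BoundedL B → leadL (A *L B) ≋ leadL A ⊛ leadL B
  leadL-*L (lau _ f) (lau _ g) = leadS-⊛ f g

  prodS : ∀ {A : Set} → (A → Seq) → List A → Seq
  prodS g l = foldr _⊛_ 1S (map g l)

  powS : ℕ → Seq → Seq
  powS k X = prodS (λ _ → X) (upTo k)

  prodS-cong : ∀ {A : Set} {g g′ : A → Seq} l → (∀ x → g x ≋ g′ x) → prodS g l ≋ prodS g′ l
  prodS-cong [] g≋g′ = SR.refl
  prodS-cong (x ∷ l) g≋g′ = SR.*-cong (g≋g′ x) (prodS-cong l g≋g′)

  prodS-⊛ : ∀ {A : Set} (f g : A → Seq) l → prodS f l ⊛ prodS g l ≋ prodS (λ x → f x ⊛ g x) l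
  prodS-⊛ f g [] = SR.*-identityˡ 1S
  prodS-⊛ f g (x ∷ l) = SR.trans (interchange (f x) (prodS f l) (g x) (prodS g l))
                                  (SR.*-cong (SR.refl {f x ⊛ g x}) (prodS-⊛ f g l))
    where open import Algebra.Properties.CommutativeSemigroup SR.*-commutativeSemigroup using (interchange)

  leadL-prodL : ∀ {A : Set} (f : A → Lau (m ℕ.+ m)) l → (∀ x → BoundedL (f x)) →
    BoundedL (prodL (map f l)) × leadL (prodL (map f l)) ≋ prodS (leadL ∘ f) l
  leadL-prodL f [] bf = bounded-1L , lead-1L
    where
      bounded-1L : BoundedL 1L
      bounded-1L zero = Deg-1P
      bounded-1L (suc N) = Deg-0P
      lead-1L : leadL 1L ≋ 1S
      lead-1L zero = lead-of-Deg0 1P Deg-1P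
      lead-1L (suc N) = lead-0P (suc N)
  leadL-prodL f (x ∷ l) bf =
    BoundedL-*L (f x) (prodL (map f l)) (bf x) (proj₁ rest) ,
    SR.trans (leadL-*L (f x) (prodL (map f l)) (bf x) (proj₁ rest)) (SR.*-cong (SR.refl {leadL (f x)}) (proj₂ rest))
    where
      rest : BoundedL (prodL (map f l)) × leadL (prodL (map f l)) ≋ prodS (leadL ∘ f) l
      rest = leadL-prodL f l bf

  BoundedL-affL : ∀ α c → Deg 0 α → Deg 1 c → BoundedL (affL α c)
  BoundedL-affL α c dα dc zero = dα
  BoundedL-affL α c dα dc (suc zero) = Deg--P dc
  BoundedL-affL α c dα dc (suc (suc N)) = Deg-0P

  leadL-linL : ∀ c → leadL (linL c) ≋ oneMinus (lead 1 c)
  leadL-linL c zero = lead-of-Deg0 1P Deg-1P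
  leadL-linL c (suc zero) = lead--P 1 c
  leadL-linL c (suc (suc N)) = lead-0P _

  BoundedL-linInvL : ∀ c → Deg 1 c → BoundedL (linInvL c)
  BoundedL-linInvL c dc N = Deg-^P c dc N

  leadL-linInvL : ∀ c → Deg 1 c → leadL (linInvL c) ≋ geometric (lead 1 c)
  leadL-linInvL c dc zero = lead-of-Deg0 1P Deg-1P
  leadL-linInvL c dc (suc N) e =
    P.trans (lead-*P 1 N c (c ^P N) dc (Deg-^P c dc N) refl e)
            (PR.*-cong {lead 1 c} {lead 1 c} {lead N (c ^P N)} {geometric (lead 1 c) N}
                       (λ _ → refl) (leadL-linInvL c dc N) e)

  oneMinus-cong : ∀ {b b′} → b ≈P b′ → oneMinus b ≋ oneMinus b′
  oneMinus-cong b≈b′ zero = PR.refl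
  oneMinus-cong b≈b′ (suc zero) = PR.-‿cong b≈b′
  oneMinus-cong b≈b′ (suc (suc N)) = PR.refl

  geometric-cong : ∀ {b b′} → b ≈P b′ → geometric b ≋ geometric b′
  geometric-cong b≈b′ zero = PR.refl
  geometric-cong {b} {b′} b≈b′ (suc N) = PR.*-cong {b} {b′} b≈b′ (geometric-cong b≈b′ N)

  Deg1-1P : Deg 1 (1P {m ℕ.+ m})
  Deg1-1P = Deg-mono {f = 1P} z≤n Deg-1P

  lead1-1P : lead 1 1P ≈P 0P
  lead1-1P = lead-above-Deg 0 1P Deg-1P

  Deg1-+cst : ∀ {a} j → Deg 1 a → Deg 1 (a +P cstℕ j)
  Deg1-+cst {a} j da = Deg-+P {f = a} da (Deg-mono {f = cstℕ {m ℕ.+ m} j} z≤n (Deg-cst (+ j ℚ./ 1)))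

  lead1-+cst : ∀ a j → lead 1 (a +P cstℕ j) ≈P lead 1 a
  lead1-+cst a j e = P.trans (lead-+P 1 a (cstℕ j) e)
    (P.trans (cong (lead 1 a e ℚ.+_) (lead-above-Deg 0 (cstℕ j) (Deg-cst (+ j ℚ./ 1)) e)) (ℚP.+-identityʳ _))

  leadL-ffL : ∀ a k b → Deg 1 a → lead 1 a ≈P b → BoundedL (ffL a k) × leadL (ffL a k) ≋ powS k (oneMinus b)
  leadL-ffL a k b da a₁≈b = proj₁ factors , SR.trans (proj₂ factors)
      (prodS-cong (upTo k) (λ j → SR.trans (leadL-linL (a +P cstℕ j))
                                           (oneMinus-cong (PR.trans (lead1-+cst a j) a₁≈b))))
    where
      factors : BoundedL (ffL a k) × leadL (ffL a k) ≋ prodS (λ j → leadL (linL (a +P cstℕ j))) (upTo k)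
      factors = leadL-prodL (λ j → linL (a +P cstℕ j)) (upTo k)
                            (λ j → BoundedL-affL 1P _ Deg-1P (Deg1-+cst j da))

  leadL-ffInvL : ∀ a k b → Deg 1 a → lead 1 a ≈P b → BoundedL (ffInvL a k) × leadL (ffInvL a k) ≋ powS k (geometric b)
  leadL-ffInvL a k b da a₁≈b = proj₁ factors , SR.trans (proj₂ factors)
      (prodS-cong (upTo k) (λ j → SR.trans (leadL-linInvL (a +P cstℕ j) (Deg1-+cst j da))
                                           (geometric-cong (PR.trans (lead1-+cst a j) a₁≈b))))
    where
      factors : BoundedL (ffInvL a k) × leadL (ffInvL a k) ≋ prodS (λ j → leadL (linInvL (a +P cstℕ j))) (upTo k)
      factors = leadL-prodL (λ j → linInvL (a +P cstℕ j)) (upTo k) (λ j → BoundedL-linInvL _ (Deg1-+cst j da))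

  NNS : Seq → Set
  NNS A = ∀ N → NN (A N)

  NNS-resp : ∀ {A B} → A ≋ B → NNS A → NNS B
  NNS-resp A≋B nA N = NN-resp (A≋B N) (nA N)

  NNS-⊛ : ∀ {A B} → NNS A → NNS B → NNS (A ⊛ B)
  NNS-⊛ {A} {B} nA nB N = NN-sumP (λ i → A i *P B (N ∸ i)) (upTo (suc N)) (λ i → NN-*P (nA i) (nB (N ∸ i)))

  NNS-prodS : ∀ {A : Set} (g : A → Seq) l → (∀ x → NNS (g x)) → NNS (prodS g l)
  NNS-prodS g [] ng zero = NN-1P
  NNS-prodS g [] ng (suc N) = NN-0P
  NNS-prodS g (x ∷ l) ng = NNS-⊛ (ng x) (NNS-prodS g l ng)

  module Factor (k : ℕ) (i : Fin m) where
    q p a : MPoly (m ℕ.+ m)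
    q = qV m i
    p = pV m i
    a = q +P p

    lead-c₁ : lead 1 (q +P 1P) ≈P q
    lead-c₁ e = P.trans (lead-+P 1 q 1P e) (P.trans (cong₂ ℚ._+_ (lead-q i e) (lead1-1P e)) (ℚP.+-identityʳ _))

    lead-c₂ : lead 1 (-P q) ≈P (-P q)
    lead-c₂ e = P.trans (lead--P 1 q e) (cong ℚ.-_ (lead-q i e))

    lead-c₃ : lead 1 ((q +P (-P p)) +P 1P) ≈P a
    lead-c₃ e = P.trans (lead-+P 1 (q +P (-P p)) 1P e)
      (P.trans (cong₂ ℚ._+_ (P.trans (lead-+P 1 q (-P p) e) (cong₂ ℚ._+_ (lead-q i e) lead-p′)) (lead1-1P e))
               (ℚP.+-identityʳ _))
      where
        open import Algebra.Properties.Ring PR.ring using (-‿involutive)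
        lead-p′ : lead 1 (-P p) e ≡ p e
        lead-p′ = P.trans (lead--P 1 p e) (P.trans (cong ℚ.-_ (lead-p i e)) (-‿involutive p e))

    lead-c₄ : lead 1 (p +P (-P q)) ≈P (-P a)
    lead-c₄ e = P.trans (lead-+P 1 p (-P q) e) (P.trans (cong₂ ℚ._+_ (lead-p i e) (lead-c₂ e))
      (P.trans (ℚP.+-comm (ℚ.- p e) (ℚ.- q e)) (P.sym (ℚP.neg-distrib-+ (q e) (p e)))))

    F₁ F₂ F₃ F₄ : Lau (m ℕ.+ m)
    F₁ = ffL (q +P 1P) k
    F₂ = ffL (-P q) k
    F₃ = ffInvL ((q +P (-P p)) +P 1P) k
    F₄ = ffInvL (p +P (-P q)) k

    r₁ : BoundedL F₁ × leadL F₁ ≋ powS k (oneMinus q)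
    r₁ = leadL-ffL (q +P 1P) k q (Deg-+P (Deg-var (m ↑ʳ i)) Deg1-1P) lead-c₁
    r₂ : BoundedL F₂ × leadL F₂ ≋ powS k (oneMinus (-P q))
    r₂ = leadL-ffL (-P q) k (-P q) (Deg--P (Deg-var (m ↑ʳ i))) lead-c₂
    r₃ : BoundedL F₃ × leadL F₃ ≋ powS k (geometric a)
    r₃ = leadL-ffInvL ((q +P (-P p)) +P 1P) k a
           (Deg-+P (Deg-+P (Deg-var (m ↑ʳ i)) (Deg--P (Deg-var (i ↑ˡ m)))) Deg1-1P) lead-c₃
    r₄ : BoundedL F₄ × leadL F₄ ≋ powS k (geometric (-P a))
    r₄ = leadL-ffInvL (p +P (-P q)) k (-P a) (Deg-+P (Deg-var (i ↑ˡ m)) (Deg--P (Deg-var (m ↑ʳ i)))) lead-c₄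

    b₃₄ : BoundedL (F₃ *L F₄)
    b₃₄ = BoundedL-*L F₃ F₄ (proj₁ r₃) (proj₁ r₄)
    b₂₃₄ : BoundedL (F₂ *L (F₃ *L F₄))
    b₂₃₄ = BoundedL-*L F₂ (F₃ *L F₄) (proj₁ r₂) b₃₄

    bounded : BoundedL (factorL k m i)
    bounded = BoundedL-*L F₁ (F₂ *L (F₃ *L F₄)) (proj₁ r₁) b₂₃₄

    leadL-factor : leadL (factorL k m i) ≋ powS k (Quotient.quotient a q)
    leadL-factor =
      SR.trans (leadL-*L F₁ (F₂ *L (F₃ *L F₄)) (proj₁ r₁) b₂₃₄)
      (SR.trans (SR.*-cong (proj₂ r₁) (SR.trans (leadL-*L F₂ (F₃ *L F₄) (proj₁ r₂) b₃₄)
                (SR.*-cong (proj₂ r₂) (SR.trans (leadL-*L F₃ F₄ (proj₁ r₃) (proj₁ r₄))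
                                                (SR.*-cong (proj₂ r₃) (proj₂ r₄))))))
      (SR.trans (SR.*-cong (SR.refl {powS k (oneMinus q)})
                  (SR.*-cong (SR.refl {powS k (oneMinus (-P q))}) (prodS-⊛ _ _ (upTo k))))
      (SR.trans (SR.*-cong (SR.refl {powS k (oneMinus q)}) (prodS-⊛ _ _ (upTo k)))
      (SR.trans (prodS-⊛ _ _ (upTo k))
                (prodS-cong (upTo k) (λ _ → numerator-⊛-geometrics a q))))))

    -- a² - q² = q p + p a has nonnegative coefficients, hence so does the quotient
    a²-q²≈ : Quotient.a²-q² a q ≈P ((q *P p) +P (p *P a))
    a²-q²≈ = PR.trans (PR.+-cong (PR.trans (PR.distribʳ a q p) (PR.+-cong (PR.distribˡ q q p) (PR.refl {p *P a})))
                                 (PR.refl { -P (q *P q)}))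
      (PR.trans (regroup (q *P q) (q *P p) (p *P a) (-P (q *P q)))
      (PR.trans (PR.+-cong (PR.refl {(q *P p) +P (p *P a)}) (PR.-‿inverseʳ (q *P q))) (PR.+-identityʳ _)))
      where
        open import Algebra.Solver.CommutativeMonoid PR.+-commutativeMonoid using (solve; _⊜_) renaming (_⊕_ to _⊙_)
        regroup : ∀ x y z w → ((x +P y) +P z) +P w ≈P (y +P z) +P (x +P w)
        regroup = solve 4 (λ x y z w → ((x ⊙ y) ⊙ z) ⊙ w ⊜ (y ⊙ z) ⊙ (x ⊙ w)) PR.refl

    NN-a : NN a
    NN-a = NN-+P (NN-var (m ↑ʳ i)) (NN-var (i ↑ˡ m))

    NNS-evenPowers : NNS (Quotient.evenPowers a q)
    NNS-evenPowers zero = NN-1P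
    NNS-evenPowers (suc zero) = NN-0P
    NNS-evenPowers (suc (suc N)) = NN-*P (NN-*P NN-a NN-a) (NNS-evenPowers N)

    NNS-quotient : NNS (Quotient.quotient a q)
    NNS-quotient zero = NN-1P
    NNS-quotient (suc zero) = NN-0P
    NNS-quotient (suc (suc N)) = NN-*P
      (NN-resp (PR.sym a²-q²≈) (NN-+P (NN-*P (NN-var (m ↑ʳ i)) (NN-var (i ↑ˡ m))) (NN-*P (NN-var (i ↑ˡ m)) NN-a)))
      (NNS-evenPowers N)

    NNS-factor : NNS (leadL (factorL k m i))
    NNS-factor = NNS-resp (SR.sym leadL-factor) (NNS-prodS _ (upTo k) (λ _ → NNS-quotient))

  NNS-exprL : ∀ k → NNS (leadL (exprL k m))
  NNS-exprL k = NNS-resp (SR.sym lead≋) (NNS-⊛ NNS-A₁ (NNS-⊛ NNS-A₂ NNS-A₃))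
    where
      A₁ A₂ A₃ : Lau (m ℕ.+ m)
      A₁ = affL (cstℕ 2) (cstℕ k)
      A₂ = ffL 1P (k ∸ 1)
      A₃ = prodL (map (factorL k m) (allFin m))

      b₁ : BoundedL A₁
      b₁ = BoundedL-affL (cstℕ 2) (cstℕ k) (Deg-cst (+ 2 ℚ./ 1)) (Deg-mono {f = cstℕ k} z≤n (Deg-cst (+ k ℚ./ 1)))
      r₂ : BoundedL A₂ × leadL A₂ ≋ powS (k ∸ 1) (oneMinus 0P)
      r₂ = leadL-ffL 1P (k ∸ 1) 0P Deg1-1P lead1-1P
      r₃ : BoundedL A₃ × leadL A₃ ≋ prodS (leadL ∘ factorL k m) (allFin m)
      r₃ = leadL-prodL (factorL k m) (allFin m) (Factor.bounded k)

      lead≋ : leadL (exprL k m) ≋ leadL A₁ ⊛ (leadL A₂ ⊛ leadL A₃)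
      lead≋ = SR.trans (leadL-*L A₁ (A₂ *L A₃) b₁ (BoundedL-*L A₂ A₃ (proj₁ r₂) (proj₁ r₃)))
                       (SR.*-cong (SR.refl {leadL A₁}) (leadL-*L A₂ A₃ (proj₁ r₂) (proj₁ r₃)))

      -- leadL A₁ = 2, since the constant k has no degree-1 part
      NNS-A₁ : NNS (leadL A₁)
      NNS-A₁ zero = NN-resp (PR.sym (lead-of-Deg0 (cstℕ 2) (Deg-cst (+ 2 ℚ./ 1))))
                            (λ e → 0≤* (ℚP.nonNegative⁻¹ _ {{ℚP.normalize-nonNeg 2 1}}) (NN-1P e))
      NNS-A₁ (suc zero) = NN-resp (PR.sym (PR.trans (lead--P 1 (cstℕ k))
                                    (PR.-‿cong (lead-above-Deg 0 (cstℕ k) (Deg-cst (+ k ℚ./ 1)))))) NN-0P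
      NNS-A₁ (suc (suc N)) = NN-resp (PR.sym (lead-0P _)) NN-0P

      NNS-A₂ : NNS (leadL A₂)
      NNS-A₂ = NNS-resp (SR.sym (proj₂ r₂)) (NNS-prodS _ (upTo (k ∸ 1)) (λ _ → NNS-oneMinus-0P))
        where
          NNS-oneMinus-0P : NNS (oneMinus 0P)
          NNS-oneMinus-0P zero = NN-1P
          NNS-oneMinus-0P (suc zero) = NN-0P
          NNS-oneMinus-0P (suc (suc N)) = NN-0P

      NNS-A₃ : NNS (leadL A₃)
      NNS-A₃ = NNS-resp (SR.sym (proj₂ r₃)) (NNS-prodS _ (allFin m) (Factor.NNS-factor k))

module Shifts where
  open import Data.Nat as ℕ using (suc)
  open import Data.Integer as ℤ using (+_; -[1+_])
  import Data.Integer.Properties as ℤP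
  open import Data.Integer.Solver using (module +-*-Solver)
  open import Data.List using (List; _∷_; []; map; upTo; length; allFin)
  open import Data.List.Properties using (length-upTo)
  open import Data.Fin using (Fin)
  open import Relation.Binary.PropositionalEquality as P using (_≡_; refl; cong; cong₂)

  open +-*-Solver

  shift-prodL : ∀ {n} {A : Set} (f : A → Lau n) (l : List A) s → (∀ x → shift (f x) ≡ s) →
    shift (prodL (map f l)) ≡ + length l ℤ.* s
  shift-prodL f [] s _ = P.sym (ℤP.*-zeroˡ s)
  shift-prodL f (x ∷ l) s sf = P.trans (cong₂ ℤ._+_ (sf x) (shift-prodL f l s sf))
    (P.sym (P.trans (ℤP.*-distribʳ-+ s (+ 1) (+ length l)) (cong (ℤ._+ (+ length l ℤ.* s)) (ℤP.*-identityˡ s))))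

  shift-ffL : ∀ {n} (a : MPoly n) k → shift (ffL a k) ≡ + k ℤ.* + 1
  shift-ffL a k = P.trans (shift-prodL (λ j → linL (a +P cstℕ j)) (upTo k) (+ 1) (λ _ → refl))
                          (cong (λ l → + l ℤ.* + 1) (length-upTo k))

  shift-ffInvL : ∀ {n} (a : MPoly n) k → shift (ffInvL a k) ≡ + k ℤ.* -[1+ 0 ]
  shift-ffInvL a k = P.trans (shift-prodL (λ j → linInvL (a +P cstℕ j)) (upTo k) -[1+ 0 ] (λ _ → refl))
                             (cong (λ l → + l ℤ.* -[1+ 0 ]) (length-upTo k))

  -- each factor has as many falling factorials above as below the line
  shift-factorL : ∀ k m (i : Fin m) → shift (factorL k m i) ≡ + 0
  shift-factorL k m i = P.trans
    (cong₂ ℤ._+_ (shift-ffL (q +P 1P) k) (cong₂ ℤ._+_ (shift-ffL (-P q) k)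
      (cong₂ ℤ._+_ (shift-ffInvL ((q +P (-P p)) +P 1P) k) (shift-ffInvL (p +P (-P q)) k))))
    (balance (+ k))
    where
      p q : MPoly (m ℕ.+ m)
      p = pV m i
      q = qV m i
      balance : ∀ x → x ℤ.* + 1 ℤ.+ (x ℤ.* + 1 ℤ.+ (x ℤ.* -[1+ 0 ] ℤ.+ x ℤ.* -[1+ 0 ])) ≡ + 0
      balance = solve 1 (λ x → x :* con (+ 1) :+ (x :* con (+ 1) :+ (x :* con -[1+ 0 ] :+ x :* con -[1+ 0 ]))
                               := con (+ 0)) refl

  coeffZInv-at : ∀ {n} s (g : PS n) N → s ℤ.+ + 1 ≡ + N → coeffZInv (lau s g) ≡ g N
  coeffZInv-at s g N eq rewrite eq = refl

  coeffZInv-exprL : ∀ k′ m → coeffZInv (exprL (suc k′) m) ≡ ser (exprL (suc k′) m) (suc (suc k′))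
  coeffZInv-exprL k′ m = coeffZInv-at (shift (exprL (suc k′) m)) (ser (exprL (suc k′) m)) (suc (suc k′)) shift≡
    where
      shift≡ : shift (exprL (suc k′) m) ℤ.+ + 1 ≡ + suc (suc k′)
      shift≡ = P.trans
        (cong (λ s → (+ 1 ℤ.+ s) ℤ.+ + 1)
              (cong₂ ℤ._+_ (shift-ffL 1P k′) (shift-prodL (factorL (suc k′) m) (allFin m) (+ 0) (shift-factorL (suc k′) m))))
        (count (+ k′) (+ length (allFin m)))
        where
          count : ∀ x y → (+ 1 ℤ.+ (x ℤ.* + 1 ℤ.+ y ℤ.* + 0)) ℤ.+ + 1 ≡ + 2 ℤ.+ x
          count = solve 2 (λ x y → (con (+ 1) :+ (x :* con (+ 1) :+ y :* con (+ 0))) :+ con (+ 1)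
                                   := con (+ 2) :+ x) refl

open import Data.Nat as ℕ using (ℕ; zero; suc; _≤_; _%_)
open import Data.Vec using (Vec)
import Data.Nat
open import Data.Rational as ℚ using (ℚ; 0ℚ; -_) renaming (_≤_ to _≤ℚ_)
import Data.Rational.Properties as ℚP
open import Relation.Binary.PropositionalEquality as P using (_≡_; cong)
open Nonnegativity
open Shifts

negated-L : ∀ k m e →
  - (negP m (L k m) e) ≡ invFourK k ℚ.* LeadingPart.lead m (suc k) (coeffZInv (exprL k m)) e
negated-L k m e = P.trans (cong -_ (lead-scale (suc k) (- c) Y e))
  (P.trans (cong -_ (P.sym (ℚP.neg-distribˡ-* c (lead (suc k) Y e)))) (-‿involutive (c ℚ.* lead (suc k) Y e)))
  where
    open LeadingPart m
    open import Algebra.Properties.Ring (CommutativeRing.ring ℚP.+-*-commutativeRing) using (-‿involutive)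
    c : ℚ
    c = invFourK k
    Y : MPoly (m ℕ.+ m)
    Y = coeffZInv (exprL k m)

invFourK-nonneg : ∀ k → 0ℚ ≤ℚ invFourK k
invFourK-nonneg zero = ℚP.≤-refl
invFourK-nonneg (suc k) = ℚP.nonNegative⁻¹ _ {{ℚP.normalize-nonNeg 1 (4 ℕ.* suc k)}}

mainTheorem10 : (k m : ℕ) → k % 2 ≡ 1 → 1 ≤ m →
    (e : Vec ℕ (m Data.Nat.+ m)) → 0ℚ ≤ℚ (- (negP m (L k m) e))
mainTheorem10 zero m () _ e
mainTheorem10 (suc k′) m _ _ e =
  P.subst (0ℚ ≤ℚ_) (P.sym (negated-L (suc k′) m e))
    (0≤* (invFourK-nonneg (suc k′))
         (P.subst (λ Y → 0ℚ ≤ℚ lead (suc (suc k′)) Y e) (P.sym (coeffZInv-exprL k′ m))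
                  (NNS-exprL (suc k′) (suc (suc k′)) e)))
  where
    open LeadingPart m
    open LeadingSeries m
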